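{- Let $q$ be an odd prime power, $\delta\in\mathbb{F}_{q^2}$ and $\gamma\in\mathbb{F}_q^*$. Then the polynomial $$f(x)=(x^q-x+\delta)^{2q+3}+(x^q-x+\delta)^{5q}+\gamma x$$ is a permutation polynomial of $\mathbb{F}_{q^2}$ if and only if one of the following holds: (i) $\mathrm{Tr}_q^{q^2}(\delta)=0$; (ii) $\mathrm{Tr}_q^{q^2}(\delta)\neq0$, $3\mid q$ and $\gamma\neq\left(\mathrm{Tr}_q^{q^2}(\delta)\right)^4$; (iii) $\mathrm{Tr}_q^{q^2}(\delta)\neq0$, $q\equiv2\pmod 3$ and $\gamma=-\left(\mathrm{Tr}_q^{q^2}(\delta)\right)^4/2$.
   Context: A polynomial over a finite field $\mathbb{F}$ is a permutation polynomial of $\mathbb{F}$ if the map it induces on $\mathbb{F}$ is a bijection. For $x\in\mathbb{F}_{q^2}$, $\mathrm{Tr}_q^{q^2}(x)=x+x^q$. -}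

module Defs where

open import Level using (Level; _⊔_)
open import Data.Nat as ℕ using (ℕ; zero; suc; _≤_)
open import Data.Nat.Divisibility using (_∣_)
open import Data.Nat.Primality using (Prime)
open import Data.Fin using (Fin)
open import Data.Product using (∃; _×_)
open import Relation.Nullary using (¬_)
open import Relation.Binary.PropositionalEquality as ≡ using (_≡_)
open import Algebra.Bundles using (CommutativeRing)
open import Function.Bundles using (Bijection)
open import Function.Definitions using (Bijective)

IsOddPrimePower : ℕ → Set
IsOddPrimePower q = ∃ λ p → ∃ λ k → Prime p × 1 ≤ k × q ≡ p ℕ.^ k × ¬ (2 ∣ q)

module _ {c ℓ : Level} (R : CommutativeRing c ℓ) where
  open CommutativeRing R

  pow : Carrier → ℕ → Carrier
  pow x zero    = 1#
  pow x (suc n) = x * pow x n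

  record IsFiniteFieldOfOrder (N : ℕ) : Set (c ⊔ ℓ) where
    field
      1≉0     : ¬ (1# ≈ 0#)
      inverse : ∀ x → ¬ (x ≈ 0#) → ∃ λ y → x * y ≈ 1#
      enum    : Bijection (≡.setoid (Fin N)) setoid

  IsPermutation : (Carrier → Carrier) → Set (c ⊔ ℓ)
  IsPermutation f = Bijective _≈_ _≈_ f

  Tr : ℕ → Carrier → Carrier
  Tr q x = x + pow x q

{-# OPTIONS --safe #-}
module Submission where

-- Write σ x = x ^ q, t = Tr δ = δ + σ δ and y x = σ x - x + δ, so that σ (y x) = t - y x, and f (x + a) = f x + γ a
-- whenever σ a = a.  Applying σ - id to f leaves x only through y: σ (f x) - f x = G (y x), where
--   2 (G y₁ - G y₂) = (y₁ - y₂) K(s₁, s₂),   sᵢ = 2 yᵢ - t,   K(s₁, s₂) = t⁴ + 2γ + 3t² (s₁² + s₁ s₂ + s₂²),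
-- and the sᵢ run over all trace-zero elements.  Hence f permutes F_{q²} iff K(s₁, s₂) = 0 forces s₁ = s₂ on
-- trace-zero elements.  If t = 0 or 3 ∣ q, K is the constant 2γ or t⁴ - γ.  Otherwise K vanishes iff
-- s₁² + s₁ s₂ + s₂² = e := -(t⁴ + 2γ) / 3t² ∈ F_q.  With a primitive cube root of unity ζ this form factors as
-- (s₁ - ζ s₂)(s₁ - ζ² s₂): for q ≡ 2 (mod 3) it has no nontrivial zero on trace-zero elements, and, using that the
-- norm x ↦ x^(q+1) maps onto F_q*, it takes every nonzero value of F_q (and 0 if q ≡ 1 (mod 3)) at two distinct
-- trace-zero elements.

open import Level using (Level; _⊔_)
open import Function.Base using (_∘_; id)
open import Function.Bundles using (Bijection; _⇔_; mk⇔)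
open import Function.Definitions using (Congruent; Injective; Bijective)
open import Relation.Binary.Definitions using (Decidable)
open import Relation.Binary.PropositionalEquality as ≡ using (_≡_; _≢_)
open import Relation.Nullary using (¬_; Dec; yes; no)
open import Relation.Nullary.Decidable using (map′; decidable-stable; ¬?; from-yes)
open import Data.Empty using (⊥-elim)
open import Data.Maybe using (Maybe; just; nothing)
open import Data.Product using (∃; Σ-syntax; _,_; proj₁; proj₂)
open import Data.Sum using (_⊎_; inj₁; inj₂; [_,_]′; reduce)
open import Data.Nat as ℕ using (ℕ; zero; suc; _≤_; _<_; z≤n; s≤s; _%_; _/_)
import Data.Nat.Properties as ℕ
open import Data.Nat.Combinatorics using (_C_; nC1≡n; nCn≡1; nCk+nC[k+1]≡[n+1]C[k+1])
open import Data.Nat.Coprimality using (Coprime; coprime-Bézout)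
open import Data.Nat.DivMod using (m≡m%n+[m/n]*n; m%n<n; %-distribˡ-*)
open import Data.Nat.Divisibility
  using (_∣_; _∣?_; divides; ∣-refl; ∣⇒≤; ∣m⇒∣m*n; m∣m*n; ∣1⇒≡1; m%n≡0⇒n∣m; n∣m⇒m%n≡0)
open import Data.Nat.GCD using (module Bézout)
open import Data.Nat.Primality
  using (Prime; prime[2]; prime?; euclidsLemma; prime⇒nonTrivial; prime⇒nonZero; prime⇒irreducible)
open import Data.Nat.Solver using (module +-*-Solver)
open import Data.Integer as ℤ using (ℤ)
import Data.Integer.Properties as ℤ
open import Data.Fin as Fin using (Fin; zero; suc; toℕ; fromℕ; inject₁)
import Data.Fin.Properties as Fin
open import Data.Fin.Permutation using (Permutation; permutation; _⟨$⟩ʳ_)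
open import Data.Vec.Functional using (init; removeAt)
open import Algebra.Bundles using (CommutativeRing)
import Algebra.Properties.Ring
import Algebra.Properties.Semiring.Mult.TCOptimised
import Algebra.Properties.Monoid.Sum
import Algebra.Properties.CommutativeMonoid.Sum
import Algebra.Solver.Ring
open import Algebra.Solver.Ring.AlmostCommutativeRing
  using (fromCommutativeRing; _-Raw-AlmostCommutative⟶_)
open import Defs

[1+k]*[1+n]C[1+k]≡[1+n]*nCk : ∀ n k → suc k ℕ.* (suc n C suc k) ≡ suc n ℕ.* (n C k)
[1+k]*[1+n]C[1+k]≡[1+n]*nCk zero    zero    = ≡.refl
[1+k]*[1+n]C[1+k]≡[1+n]*nCk zero    (suc k) = ℕ.*-zeroʳ (suc (suc k))
[1+k]*[1+n]C[1+k]≡[1+n]*nCk (suc n) zero    = begin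
  1 ℕ.* (suc (suc n) C 1)        ≡⟨ ℕ.*-identityˡ _ ⟩
  suc (suc n) C 1                ≡⟨ nC1≡n (suc (suc n)) ⟩
  suc (suc n)                    ≡⟨ ℕ.*-identityʳ _ ⟨
  suc (suc n) ℕ.* 1              ∎
  where open ≡.≡-Reasoning
[1+k]*[1+n]C[1+k]≡[1+n]*nCk (suc n) (suc k) = begin
  suc (suc k) ℕ.* (suc (suc n) C suc (suc k))
    ≡⟨ ≡.cong (suc (suc k) ℕ.*_) (nCk+nC[k+1]≡[n+1]C[k+1] (suc n) (suc k)) ⟨
  suc (suc k) ℕ.* (a ℕ.+ b)
    ≡⟨ solve 3 (λ k a b → (con 2 :+ k) :* (a :+ b) := ((con 1 :+ k) :* a :+ a) :+ (con 2 :+ k) :* b) ≡.refl k a b ⟩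
  (suc k ℕ.* a ℕ.+ a) ℕ.+ suc (suc k) ℕ.* b
    ≡⟨ ≡.cong₂ (λ u v → (u ℕ.+ a) ℕ.+ v) ([1+k]*[1+n]C[1+k]≡[1+n]*nCk n k)
                                        ([1+k]*[1+n]C[1+k]≡[1+n]*nCk n (suc k)) ⟩
  (suc n ℕ.* c ℕ.+ a) ℕ.+ suc n ℕ.* d
    ≡⟨ solve 4 (λ n a c d → ((con 1 :+ n) :* c :+ a) :+ (con 1 :+ n) :* d := a :+ (con 1 :+ n) :* (c :+ d)) ≡.refl n a c d ⟩
  a ℕ.+ suc n ℕ.* (c ℕ.+ d)
    ≡⟨ ≡.cong (λ z → a ℕ.+ suc n ℕ.* z) (nCk+nC[k+1]≡[n+1]C[k+1] n k) ⟩
  a ℕ.+ suc n ℕ.* a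
    ∎
  where
  open ≡.≡-Reasoning
  open +-*-Solver
  a = suc n C suc k
  b = suc n C suc (suc k)
  c = n C k
  d = n C suc k

p∣pCk : ∀ {p} → Prime p → ∀ {k} → 0 < k → k < p → p ∣ (p C k)
p∣pCk {suc n} p-prime {suc k} _ k<p with euclidsLemma (suc k) (suc n C suc k) p-prime
  (≡.subst (suc n ∣_) (≡.sym ([1+k]*[1+n]C[1+k]≡[1+n]*nCk n k)) (∣m⇒∣m*n (n C k) ∣-refl))
... | inj₁ p∣k+1 = ⊥-elim (ℕ.<⇒≱ k<p (∣⇒≤ p∣k+1))
... | inj₂ p∣pCk = p∣pCk

prime[3] : Prime 3
prime[3] = from-yes (prime? 3)

prime∣^⇒∣ : ∀ {d m} k → Prime d → d ∣ m ℕ.^ k → d ∣ m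
prime∣^⇒∣ zero    d-prime d∣1 with ≡.refl ← ∣1⇒≡1 d∣1 | () ← prime⇒nonTrivial d-prime
prime∣^⇒∣ (suc k) d-prime d∣m^[1+k] with euclidsLemma _ _ d-prime d∣m^[1+k]
... | inj₁ d∣m   = d∣m
... | inj₂ d∣m^k = prime∣^⇒∣ k d-prime d∣m^k

n%3≡1⊎n%3≡2 : ∀ n → ¬ 3 ∣ n → n % 3 ≡ 1 ⊎ n % 3 ≡ 2
n%3≡1⊎n%3≡2 n 3∤n = nonzero-residue (m%n<n n 3) (3∤n ∘ m%n≡0⇒n∣m n 3)
  where
  nonzero-residue : ∀ {r} → r < 3 → r ≢ 0 → r ≡ 1 ⊎ r ≡ 2
  nonzero-residue {0} _ r≢0 = ⊥-elim (r≢0 ≡.refl)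
  nonzero-residue {1} _ _   = inj₁ ≡.refl
  nonzero-residue {2} _ _   = inj₂ ≡.refl
  nonzero-residue {suc (suc (suc _))} (s≤s (s≤s (s≤s ()))) _

n%3≡1+r⇒3∤n : ∀ {n r} → n % 3 ≡ suc r → ¬ 3 ∣ n
n%3≡1+r⇒3∤n {n} n%3≡1+r 3∣n with () ← ≡.trans (≡.sym (n∣m⇒m%n≡0 n 3 3∣n)) n%3≡1+r

n*n%3≡1 : ∀ n → ¬ 3 ∣ n → (n ℕ.* n) % 3 ≡ 1
n*n%3≡1 n 3∤n = ≡.trans (%-distribˡ-* n n 3) ([ square-mod-3 , square-mod-3 ]′ (n%3≡1⊎n%3≡2 n 3∤n))
  where
  square-mod-3 : ∀ {r} → n % 3 ≡ r → ((n % 3) ℕ.* (n % 3)) % 3 ≡ (r ℕ.* r) % 3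
  square-mod-3 = ≡.cong (λ r → (r ℕ.* r) % 3)

[q+1][q-1]≡q*q-1 : ∀ q → 2 ≤ q → suc q ℕ.* suc (q ℕ.∸ 2) ≡ ℕ.pred (q ℕ.* q)
[q+1][q-1]≡q*q-1 (suc (suc r)) (s≤s (s≤s z≤n)) =
  solve 1 (λ r → (con 3 :+ r) :* (con 1 :+ r) := con 1 :+ (r :+ (con 1 :+ r) :* (con 2 :+ r))) ≡.refl r
  where open +-*-Solver

1+[q-2][q+1]<q*q : ∀ q → 2 ≤ q → suc ((q ℕ.∸ 2) ℕ.* suc q) < q ℕ.* q
1+[q-2][q+1]<q*q (suc (suc r)) (s≤s (s≤s z≤n)) =
  ℕ.≤-trans (ℕ.m≤m+n _ (suc (suc r)))
            (ℕ.≤-reflexive (solve 1 (λ r → (con 2 :+ r :* (con 3 :+ r)) :+ (con 2 :+ r) := (con 2 :+ r) :* (con 2 :+ r))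
                                    ≡.refl r))
  where open +-*-Solver

Fin-injective⇒surjective : ∀ {n} (g : Fin n → Fin n) → Injective _≡_ _≡_ g → ∀ j → ∃ λ i → g i ≡ j
Fin-injective⇒surjective {suc n} g g-injective j with Fin.any? (λ i → g i Fin.≟ j)
... | yes hit = hit
... | no  miss = ⊥-elim (ℕ.1+n≰n (Fin.injective⇒≤ h-injective))
  where
  h : Fin (suc n) → Fin n
  h i = Fin.punchOut {i = j} (λ j≡gi → miss (i , ≡.sym j≡gi))
  h-injective : Injective _≡_ _≡_ h
  h-injective = g-injective ∘ Fin.punchOut-injective {i = j} _ _

-- Integers are interpreted through the
-- type-checking-optimised multiple _×_, so that the constant 2 is definitionally 1# + 1#, as in the theorem.
module IntegerCoefficients {c ℓ : Level} (R : CommutativeRing c ℓ) where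
  open import Data.Integer.Base using (+_; -[1+_])
  open CommutativeRing R hiding (zero)
  open Algebra.Properties.Ring ring
  open Algebra.Properties.Semiring.Mult.TCOptimised semiring using (_×_; 1+×; ×-homo-+; ×1-homo-*)
  open import Algebra.Properties.CommutativeSemigroup +-commutativeSemigroup using (interchange)
  open import Relation.Binary.Reasoning.Setoid setoid

  ⟦_⟧ : ℤ → Carrier
  ⟦ + n ⟧    = n × 1#
  ⟦ -[1+ n ] ⟧ = - (suc n × 1#)

  ⟦⟧-homo-‿ : ∀ i → ⟦ ℤ.- i ⟧ ≈ - ⟦ i ⟧
  ⟦⟧-homo-‿ (+ zero)   = sym -0#≈0#
  ⟦⟧-homo-‿ (+ suc n)  = refl
  ⟦⟧-homo-‿ -[1+ n ]   = sym (-‿involutive _)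

  ⟦⟧-homo-⊖ : ∀ m n → ⟦ m ℤ.⊖ n ⟧ ≈ m × 1# - n × 1#
  ⟦⟧-homo-⊖ zero    zero    = sym (-‿inverseʳ 0#)
  ⟦⟧-homo-⊖ zero    (suc n) = sym (+-identityˡ _)
  ⟦⟧-homo-⊖ (suc m) zero    = sym (trans (+-congˡ -0#≈0#) (+-identityʳ _))
  ⟦⟧-homo-⊖ (suc m) (suc n) = begin
    ⟦ suc m ℤ.⊖ suc n ⟧                      ≡⟨ ≡.cong ⟦_⟧ (ℤ.[1+m]⊖[1+n]≡m⊖n m n) ⟩
    ⟦ m ℤ.⊖ n ⟧                              ≈⟨ ⟦⟧-homo-⊖ m n ⟩
    m × 1# - n × 1#                          ≈⟨ +-identityˡ _ ⟨
    0# + (m × 1# - n × 1#)                   ≈⟨ +-congʳ (-‿inverseʳ 1#) ⟨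
    (1# - 1#) + (m × 1# - n × 1#)            ≈⟨ interchange _ _ _ _ ⟨
    (1# + m × 1#) + (- 1# - n × 1#)          ≈⟨ +-cong (1+× m 1#) (trans (-‿cong (1+× n 1#)) (sym (-‿+-comm 1# _))) ⟨
    suc m × 1# - suc n × 1#                  ∎

  ⟦⟧-homo-+ : ∀ i j → ⟦ i ℤ.+ j ⟧ ≈ ⟦ i ⟧ + ⟦ j ⟧
  ⟦⟧-homo-+ (+ m)    (+ n)    = ×-homo-+ 1# m n
  ⟦⟧-homo-+ (+ m)    -[1+ n ] = ⟦⟧-homo-⊖ m (suc n)
  ⟦⟧-homo-+ -[1+ m ] (+ n)    = trans (⟦⟧-homo-⊖ n (suc m)) (+-comm _ _)
  ⟦⟧-homo-+ -[1+ m ] -[1+ n ] = begin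
    ⟦ -[1+ m ] ℤ.+ -[1+ n ] ⟧                ≡⟨ ≡.cong ⟦_⟧ (ℤ.neg-distrib-+ (+ suc m) (+ suc n)) ⟨
    ⟦ ℤ.- (+ suc m ℤ.+ + suc n) ⟧            ≈⟨ ⟦⟧-homo-‿ (+ (suc m ℕ.+ suc n)) ⟩
    - ((suc m ℕ.+ suc n) × 1#)               ≈⟨ -‿cong (×-homo-+ 1# (suc m) (suc n)) ⟩
    - (suc m × 1# + suc n × 1#)              ≈⟨ -‿+-comm _ _ ⟨
    ⟦ -[1+ m ] ⟧ + ⟦ -[1+ n ] ⟧              ∎

  ⟦⟧-homo-*-pos : ∀ m n → ⟦ + m ℤ.* + n ⟧ ≈ ⟦ + m ⟧ * ⟦ + n ⟧
  ⟦⟧-homo-*-pos m n = trans (reflexive (≡.cong ⟦_⟧ (≡.sym (ℤ.pos-* m n)))) (×1-homo-* m n)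

  ⟦⟧-homo-*-posʳ : ∀ i n → ⟦ i ℤ.* + n ⟧ ≈ ⟦ i ⟧ * ⟦ + n ⟧
  ⟦⟧-homo-*-posʳ (+ m)    n = ⟦⟧-homo-*-pos m n
  ⟦⟧-homo-*-posʳ -[1+ m ] n = begin
    ⟦ -[1+ m ] ℤ.* + n ⟧                     ≡⟨ ≡.cong ⟦_⟧ (ℤ.neg-distribˡ-* (+ suc m) (+ n)) ⟨
    ⟦ ℤ.- (+ suc m ℤ.* + n) ⟧                ≈⟨ ⟦⟧-homo-‿ (+ suc m ℤ.* + n) ⟩
    - ⟦ + suc m ℤ.* + n ⟧                    ≈⟨ -‿cong (⟦⟧-homo-*-pos (suc m) n) ⟩
    - (⟦ + suc m ⟧ * ⟦ + n ⟧)                ≈⟨ -‿distribˡ-* _ _ ⟩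
    ⟦ -[1+ m ] ⟧ * ⟦ + n ⟧                   ∎

  ⟦⟧-homo-* : ∀ i j → ⟦ i ℤ.* j ⟧ ≈ ⟦ i ⟧ * ⟦ j ⟧
  ⟦⟧-homo-* i (+ n)    = ⟦⟧-homo-*-posʳ i n
  ⟦⟧-homo-* i -[1+ n ] = begin
    ⟦ i ℤ.* -[1+ n ] ⟧                       ≡⟨ ≡.cong ⟦_⟧ (ℤ.neg-distribʳ-* i (+ suc n)) ⟨
    ⟦ ℤ.- (i ℤ.* + suc n) ⟧                  ≈⟨ ⟦⟧-homo-‿ (i ℤ.* + suc n) ⟩
    - ⟦ i ℤ.* + suc n ⟧                      ≈⟨ -‿cong (⟦⟧-homo-*-posʳ i (suc n)) ⟩
    - (⟦ i ⟧ * ⟦ + suc n ⟧)                  ≈⟨ -‿distribʳ-* _ _ ⟩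
    ⟦ i ⟧ * ⟦ -[1+ n ] ⟧                     ∎

  ℤ-morphism : ℤ.+-*-rawRing -Raw-AlmostCommutative⟶ fromCommutativeRing R
  ℤ-morphism = record
    { ⟦_⟧ = ⟦_⟧ ; +-homo = ⟦⟧-homo-+ ; *-homo = ⟦⟧-homo-* ; -‿homo = ⟦⟧-homo-‿
    ; 0-homo = refl ; 1-homo = refl }

  ⟦⟧-≟ : ∀ i j → Maybe (⟦ i ⟧ ≈ ⟦ j ⟧)
  ⟦⟧-≟ i j with i ℤ.≟ j
  ... | yes ≡.refl = just refl
  ... | no _       = nothing

  2# 3# : Carrier
  2# = ⟦ + 2 ⟧
  3# = ⟦ + 3 ⟧

  module RingSolver = Algebra.Solver.Ring ℤ.+-*-rawRing (fromCommutativeRing R) ℤ-morphism ⟦⟧-≟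

module Powers {c ℓ : Level} (R : CommutativeRing c ℓ) where
  open CommutativeRing R hiding (zero)
  open Algebra.Properties.Semiring.Mult.TCOptimised semiring using (_×_; ×1-homo-*)
  open import Algebra.Properties.CommutativeSemigroup *-commutativeSemigroup using (interchange)
  import Algebra.Properties.Semiring.Exp semiring as Exp
  open import Relation.Binary.Reasoning.Setoid setoid

  -- the exponentiation of the statement, which agrees with the library's _^_ only up to ≈ (^≈Exp^)
  infixr 8 _^_
  _^_ : Carrier → ℕ → Carrier
  _^_ = pow R

  ^-congˡ : ∀ n {x y} → x ≈ y → x ^ n ≈ y ^ n
  ^-congˡ zero    x≈y = refl
  ^-congˡ (suc n) x≈y = *-cong x≈y (^-congˡ n x≈y)

  ^-homo-* : ∀ x m n → x ^ (m ℕ.+ n) ≈ x ^ m * x ^ n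
  ^-homo-* x zero    n = sym (*-identityˡ _)
  ^-homo-* x (suc m) n = trans (*-congˡ (^-homo-* x m n)) (sym (*-assoc _ _ _))

  ^-assocʳ : ∀ x m n → (x ^ m) ^ n ≈ x ^ (m ℕ.* n)
  ^-assocʳ x m zero    = reflexive (≡.cong (x ^_) (≡.sym (ℕ.*-zeroʳ m)))
  ^-assocʳ x m (suc n) = begin
    x ^ m * (x ^ m) ^ n     ≈⟨ *-congˡ (^-assocʳ x m n) ⟩
    x ^ m * x ^ (m ℕ.* n)   ≈⟨ ^-homo-* x m (m ℕ.* n) ⟨
    x ^ (m ℕ.+ m ℕ.* n)     ≡⟨ ≡.cong (x ^_) (ℕ.*-suc m n) ⟨
    x ^ (m ℕ.* suc n)       ∎

  ^-distrib-* : ∀ x y n → (x * y) ^ n ≈ x ^ n * y ^ n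
  ^-distrib-* x y zero    = sym (*-identityˡ 1#)
  ^-distrib-* x y (suc n) = trans (*-congˡ (^-distrib-* x y n)) (interchange x y (x ^ n) (y ^ n))

  1^n≈1 : ∀ n → 1# ^ n ≈ 1#
  1^n≈1 zero    = refl
  1^n≈1 (suc n) = trans (*-identityˡ _) (1^n≈1 n)

  ^-mod : ∀ {x} m n .{{_ : ℕ.NonZero m}} → x ^ m ≈ 1# → x ^ n ≈ x ^ (n % m)
  ^-mod {x} m n xᵐ≈1 = begin
    x ^ n                                  ≡⟨ ≡.cong (x ^_) (m≡m%n+[m/n]*n n m) ⟩
    x ^ (n % m ℕ.+ (n / m) ℕ.* m)          ≈⟨ ^-homo-* x (n % m) _ ⟩
    x ^ (n % m) * x ^ ((n / m) ℕ.* m)      ≡⟨ ≡.cong (λ j → x ^ (n % m) * x ^ j) (ℕ.*-comm (n / m) m) ⟩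
    x ^ (n % m) * x ^ (m ℕ.* (n / m))      ≈⟨ *-congˡ (^-assocʳ x m (n / m)) ⟨
    x ^ (n % m) * (x ^ m) ^ (n / m)        ≈⟨ *-congˡ (trans (^-congˡ (n / m) xᵐ≈1) (1^n≈1 (n / m))) ⟩
    x ^ (n % m) * 1#                       ≈⟨ *-identityʳ _ ⟩
    x ^ (n % m)                            ∎

  ^≈Exp^ : ∀ x n → x ^ n ≈ x Exp.^ n
  ^≈Exp^ x zero    = refl
  ^≈Exp^ x (suc n) = *-congˡ (^≈Exp^ x n)

  ×1-homo-^ : ∀ m n → (m ℕ.^ n) × 1# ≈ (m × 1#) ^ n
  ×1-homo-^ m zero    = refl
  ×1-homo-^ m (suc n) = trans (×1-homo-* m (m ℕ.^ n)) (*-congˡ (×1-homo-^ m n))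


module Characteristic {c ℓ : Level} (R : CommutativeRing c ℓ) where
  open CommutativeRing R hiding (zero)
  open Powers R
  open Algebra.Properties.Semiring.Mult.TCOptimised semiring using (_×_; ×-homo-+; ×1-homo-*; ×ᵤ≈×)
  open import Relation.Binary.Reasoning.Setoid setoid

  ∣⇒×1≈0 : ∀ {p m} → p × 1# ≈ 0# → p ∣ m → m × 1# ≈ 0#
  ∣⇒×1≈0 {p} p≈0 (divides r ≡.refl) = trans (×1-homo-* r p) (trans (*-congˡ p≈0) (zeroʳ _))

  bézout⇒1≈0 : ∀ a b x y → a × 1# ≈ 0# → b × 1# ≈ 0# → 1 ℕ.+ y ℕ.* a ≡ x ℕ.* b → 1# ≈ 0#
  bézout⇒1≈0 a b x y a≈0 b≈0 eq = begin
    1#                        ≈⟨ +-identityʳ 1# ⟨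
    1# + 0#                   ≈⟨ +-congˡ (∣⇒×1≈0 a≈0 (divides y ≡.refl)) ⟨
    1# + (y ℕ.* a) × 1#       ≈⟨ ×-homo-+ 1# 1 (y ℕ.* a) ⟨
    (1 ℕ.+ y ℕ.* a) × 1#      ≡⟨ ≡.cong (_× 1#) eq ⟩
    (x ℕ.* b) × 1#            ≈⟨ ∣⇒×1≈0 b≈0 (divides x ≡.refl) ⟩
    0#                        ∎

  coprime⇒1≈0 : ∀ {p n} → p × 1# ≈ 0# → Coprime p n → n × 1# ≈ 0# → 1# ≈ 0#
  coprime⇒1≈0 {p} {n} p≈0 coprime n≈0 with coprime-Bézout coprime
  ... | Bézout.+- x y eq = bézout⇒1≈0 n p x y n≈0 p≈0 eq
  ... | Bézout.-+ x y eq = bézout⇒1≈0 p n y x p≈0 n≈0 eq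

  frobenius : ∀ {p} → Prime p → p × 1# ≈ 0# → ∀ x y → (x + y) ^ p ≈ x ^ p + y ^ p
  frobenius {0}           p-prime with () ← prime⇒nonTrivial p-prime
  frobenius {1}           p-prime with () ← prime⇒nonTrivial p-prime
  frobenius {p@(suc (suc m))} p-prime p≈0 x y = begin
    (x + y) ^ p                                  ≈⟨ ^≈Exp^ (x + y) p ⟩
    (x + y) Exp.^ p                              ≈⟨ Binomial.theorem p x y ⟩
    T zero + Σ.sum (λ i → T (suc i))             ≈⟨ +-congˡ (Σ.sum-init-last (λ i → T (suc i))) ⟩
    T zero + (Σ.sum (init (λ i → T (suc i))) + T (fromℕ p))
      ≈⟨ +-congˡ (+-congʳ (trans (Σ.sum-cong-≋ middle≈0) (Σ.sum-replicate-zero (suc m)))) ⟩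
    T zero + (0# + T (fromℕ p))                  ≈⟨ trans (+-congˡ (+-identityˡ _)) (+-comm _ _) ⟩
    T (fromℕ p) + T zero                         ≈⟨ +-cong T[p]≈x^p T[0]≈y^p ⟩
    x ^ p + y ^ p                                ∎
    where
    import Algebra.Properties.Semiring.Exp semiring as Exp
    import Algebra.Properties.CommutativeSemiring.Binomial commutativeSemiring as Binomial
    import Algebra.Properties.Semiring.Mult semiring as Mult
    module Σ = Algebra.Properties.Monoid.Sum +-monoid
    T : Fin (suc p) → Carrier
    T = Binomial.binomialTerm x y p
    T[0]≈y^p : T zero ≈ y ^ p
    T[0]≈y^p = trans (+-identityʳ _) (trans (*-identityˡ _) (sym (^≈Exp^ y p)))
    T[p]≈x^p : T (fromℕ p) ≈ x ^ p
    T[p]≈x^p = begin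
      (p C toℕ (fromℕ p)) Mult.× (x Exp.^ toℕ (fromℕ p) * y Exp.^ (p ℕ.∸ toℕ (fromℕ p)))
        ≡⟨ ≡.cong (λ j → (p C j) Mult.× (x Exp.^ j * y Exp.^ (p ℕ.∸ j))) (Fin.toℕ-fromℕ p) ⟩
      (p C p) Mult.× (x Exp.^ p * y Exp.^ (p ℕ.∸ p))
        ≡⟨ ≡.cong₂ (λ a b → a Mult.× (x Exp.^ p * y Exp.^ b)) (nCn≡1 p) (ℕ.n∸n≡0 p) ⟩
      1 Mult.× (x Exp.^ p * 1#)                   ≈⟨ +-identityʳ _ ⟩
      x Exp.^ p * 1#                              ≈⟨ *-identityʳ _ ⟩
      x Exp.^ p                                   ≈⟨ ^≈Exp^ x p ⟨
      x ^ p                                       ∎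
    middle≈0 : ∀ i → T (suc (inject₁ i)) ≈ 0#
    middle≈0 i = begin
      k Mult.× z                ≈⟨ Mult.×-congʳ k (*-identityˡ z) ⟨
      k Mult.× (1# * z)         ≈⟨ Mult.×-assoc-* k 1# z ⟨
      (k Mult.× 1#) * z         ≈⟨ *-congʳ (×ᵤ≈× k 1#) ⟩
      (k × 1#) * z              ≈⟨ *-congʳ (∣⇒×1≈0 p≈0 (p∣pCk p-prime (s≤s z≤n) (s≤s (Fin.inject₁ℕ< i)))) ⟩
      0# * z                    ≈⟨ zeroˡ z ⟩
      0#                        ∎
      where
      k = p C toℕ (suc (inject₁ i))
      z = Binomial.binomial x y p (suc (inject₁ i))

  frobenius-^ : ∀ {p} → Prime p → p × 1# ≈ 0# → ∀ j x y → (x + y) ^ (p ℕ.^ j) ≈ x ^ (p ℕ.^ j) + y ^ (p ℕ.^ j)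
  frobenius-^ p-prime p≈0 zero    x y = trans (*-identityʳ _) (sym (+-cong (*-identityʳ x) (*-identityʳ y)))
  frobenius-^ {p} p-prime p≈0 (suc j) x y = begin
    (x + y) ^ (p ℕ.* p ℕ.^ j)                     ≈⟨ ^-assocʳ (x + y) p (p ℕ.^ j) ⟨
    ((x + y) ^ p) ^ (p ℕ.^ j)                     ≈⟨ ^-congˡ (p ℕ.^ j) (frobenius p-prime p≈0 x y) ⟩
    (x ^ p + y ^ p) ^ (p ℕ.^ j)                   ≈⟨ frobenius-^ p-prime p≈0 j (x ^ p) (y ^ p) ⟩
    (x ^ p) ^ (p ℕ.^ j) + (y ^ p) ^ (p ℕ.^ j)     ≈⟨ +-cong (^-assocʳ x p (p ℕ.^ j)) (^-assocʳ y p (p ℕ.^ j)) ⟩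
    x ^ (p ℕ.* p ℕ.^ j) + y ^ (p ℕ.* p ℕ.^ j)     ∎

-- Poly n a f: the function f behaves as a polynomial of degree at most n with xⁿ-coefficient a, encoded through
-- the factor theorem: for every b, f x = f b + (x - b) g x with g of degree n - 1.
module PolynomialFunctions {c ℓ : Level} (R : CommutativeRing c ℓ) where
  open import Data.Product using (_×_)
  open CommutativeRing R hiding (zero)
  open Powers R
  open IntegerCoefficients R using (module RingSolver)
  open import Relation.Binary.Reasoning.Setoid setoid

  data Poly : ℕ → Carrier → (Carrier → Carrier) → Set (c ⊔ ℓ) where
    constant : ∀ {a f} → (∀ x → f x ≈ a) → Poly 0 a f
    factor   : ∀ {n a f} → (∀ b → Σ[ g ∈ (Carrier → Carrier) ] Poly n a g × (∀ x → f x ≈ f b + (x - b) * g x)) →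
               Poly (suc n) a f

  Poly-cong : ∀ {n a f g} → Poly n a f → (∀ x → f x ≈ g x) → Poly n a g
  Poly-cong (constant f≈a) f≈g = constant (λ x → trans (sym (f≈g x)) (f≈a x))
  Poly-cong (factor pf)    f≈g = factor λ b →
    let h , ph , f≈ = pf b in h , ph , λ x → trans (sym (f≈g x)) (trans (f≈ x) (+-congʳ (f≈g b)))

  Poly-‿x : Poly 1 (- 1#) (λ x → - x)
  Poly-‿x = factor λ b → (λ _ → - 1#) , constant (λ _ → refl) , λ x → identity x b
    where
    open RingSolver
    identity : ∀ x b → - x ≈ - b + (x - b) * - 1#
    identity = solve 2 (λ x b → :- x := :- b :+ (x :- b) :* :- con (ℤ.+ 1)) refl

  Poly-raise₁ : ∀ {n a f} → Poly n a f → Poly (suc n) 0# f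
  Poly-raise₁ (constant f≈a) = factor λ b → (λ _ → 0#) , constant (λ _ → refl) , λ x →
    trans (f≈a x) (trans (sym (f≈a b)) (sym (trans (+-congˡ (zeroʳ _)) (+-identityʳ _))))
  Poly-raise₁ (factor pf) = factor λ b → let g , pg , f≈ = pf b in g , Poly-raise₁ pg , f≈

  Poly-raise : ∀ {m n a f} → m < n → Poly m a f → Poly n 0# f
  Poly-raise {m} {suc n} m<1+n pf with m ℕ.≟ n
  ... | yes ≡.refl = Poly-raise₁ pf
  ... | no  m≢n    = Poly-raise₁ (Poly-raise (ℕ.≤∧≢⇒< (ℕ.≤-pred m<1+n) m≢n) pf)

  Poly-scale : ∀ {n a f} u → Poly n a f → Poly n (u * a) (λ x → u * f x)
  Poly-scale u (constant f≈a) = constant (λ x → *-congˡ (f≈a x))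
  Poly-scale {f = f} u (factor pf) = factor λ b → let g , pg , f≈ = pf b in
    (λ x → u * g x) , Poly-scale u pg , λ x → trans (*-congˡ (f≈ x)) (identity u (f b) (g x) x b)
    where
    open RingSolver
    identity : ∀ u fb gx x b → u * (fb + (x - b) * gx) ≈ u * fb + (x - b) * (u * gx)
    identity = solve 5 (λ u fb gx x b → u :* (fb :+ (x :- b) :* gx) := u :* fb :+ (x :- b) :* (u :* gx)) refl

  Poly-+-lower : ∀ {n a f g} → Poly n a f → Poly n 0# g → Poly n a (λ x → f x + g x)
  Poly-+-lower (constant f≈a) (constant g≈0) = constant (λ x → trans (+-cong (f≈a x) (g≈0 x)) (+-identityʳ _))
  Poly-+-lower {f = f} {g} (factor pf) (factor pg) = factor λ b →
    let f′ , pf′ , f≈ = pf b ; g′ , pg′ , g≈ = pg b in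
    (λ x → f′ x + g′ x) , Poly-+-lower pf′ pg′ ,
    λ x → trans (+-cong (f≈ x) (g≈ x)) (identity (f b) (g b) (f′ x) (g′ x) x b)
    where
    open RingSolver
    identity : ∀ fb gb fx gx x b → (fb + (x - b) * fx) + (gb + (x - b) * gx) ≈ (fb + gb) + (x - b) * (fx + gx)
    identity = solve 6 (λ fb gb fx gx x b → (fb :+ (x :- b) :* fx) :+ (gb :+ (x :- b) :* gx)
                                         := (fb :+ gb) :+ (x :- b) :* (fx :+ gx)) refl

  Poly-x* : ∀ {n a f} → Poly n a f → Poly (suc n) a (λ x → x * f x)
  Poly-x* {a = a} {f} (constant f≈a) = factor λ b → f , constant f≈a , λ x → begin
    x * f x                       ≈⟨ *-congˡ (f≈a x) ⟩
    x * a                         ≈⟨ identity x b a ⟩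
    b * a + (x - b) * a           ≈⟨ +-cong (*-congˡ (f≈a b)) (*-congˡ (f≈a x)) ⟨
    b * f b + (x - b) * f x       ∎
    where
    open RingSolver
    identity : ∀ x b a → x * a ≈ b * a + (x - b) * a
    identity = solve 3 (λ x b a → x :* a := b :* a :+ (x :- b) :* a) refl
  Poly-x* {f = f} (factor pf) = factor λ b → let g , pg , f≈ = pf b in
    (λ x → f x + b * g x) , Poly-+-lower (factor pf) (Poly-raise₁ (Poly-scale b pg)) , λ x → begin
      x * f x                                     ≈⟨ *-congˡ (f≈ x) ⟩
      x * (f b + (x - b) * g x)                   ≈⟨ identity (f b) (g x) x b ⟩
      b * f b + (x - b) * ((f b + (x - b) * g x) + b * g x)
                                                  ≈⟨ +-congˡ (*-congˡ (+-congʳ (f≈ x))) ⟨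
      b * f b + (x - b) * (f x + b * g x)         ∎
    where
    open RingSolver
    identity : ∀ fb gx x b → x * (fb + (x - b) * gx) ≈ b * fb + (x - b) * ((fb + (x - b) * gx) + b * gx)
    identity = solve 4 (λ fb gx x b → x :* (fb :+ (x :- b) :* gx)
                                   := b :* fb :+ (x :- b) :* ((fb :+ (x :- b) :* gx) :+ b :* gx)) refl

  Poly-^ : ∀ n → Poly n 1# (_^ n)
  Poly-^ zero    = constant (λ _ → refl)
  Poly-^ (suc n) = Poly-x* (Poly-^ n)

  Poly-^* : ∀ r {n a f} → Poly n a f → Poly (r ℕ.+ n) a (λ x → x ^ r * f x)
  Poly-^* zero    pf = Poly-cong pf (λ x → sym (*-identityˡ _))
  Poly-^* (suc r) pf = Poly-cong (Poly-x* (Poly-^* r pf)) (λ x → sym (*-assoc _ _ _))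

module FiniteField {c ℓ : Level} (F : CommutativeRing c ℓ) {N : ℕ} (F-finite : IsFiniteFieldOfOrder F N) where
  open CommutativeRing F hiding (zero)
  open IsFiniteFieldOfOrder F-finite
  open Powers F
  open Algebra.Properties.Ring ring using (+-identityˡ-unique; x∙y⁻¹≈ε⇒x≈y)
  open Algebra.Properties.Semiring.Mult.TCOptimised semiring using (_×_; ×ᵤ≈×)
  open import Relation.Binary.Reasoning.Setoid setoid

  private
    element : Fin N → Carrier
    element = Bijection.to enum

    index : Carrier → Fin N
    index x = proj₁ (Bijection.surjective enum x)

    element-index : ∀ x → element (index x) ≈ x
    element-index x = proj₂ (Bijection.surjective enum x) ≡.refl

    element-injective : ∀ {i j} → element i ≈ element j → i ≡ j
    element-injective = Bijection.injective enum

  infix 4 _≟_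
  _≟_ : Decidable _≈_
  x ≟ y = map′ (λ i≡j → trans (sym (element-index x)) (trans (reflexive (≡.cong element i≡j)) (element-index y)))
               (λ x≈y → element-injective (trans (element-index x) (trans x≈y (sym (element-index y)))))
               (index x Fin.≟ index y)

  inv : ∀ x → x ≉ 0# → Carrier
  inv x x≉0 = proj₁ (inverse x x≉0)

  *-inverseʳ : ∀ x (x≉0 : x ≉ 0#) → x * inv x x≉0 ≈ 1#
  *-inverseʳ x x≉0 = proj₂ (inverse x x≉0)

  *-inverseˡ : ∀ x (x≉0 : x ≉ 0#) → inv x x≉0 * x ≈ 1#
  *-inverseˡ x x≉0 = trans (*-comm _ _) (*-inverseʳ x x≉0)

  *-cancelˡ : ∀ {a x y} → a ≉ 0# → a * x ≈ a * y → x ≈ y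
  *-cancelˡ {a} {x} {y} a≉0 ax≈ay = begin
    x                       ≈⟨ *-identityˡ x ⟨
    1# * x                  ≈⟨ *-congʳ (*-inverseˡ a a≉0) ⟨
    (inv a a≉0 * a) * x     ≈⟨ *-assoc _ a x ⟩
    inv a a≉0 * (a * x)     ≈⟨ *-congˡ ax≈ay ⟩
    inv a a≉0 * (a * y)     ≈⟨ *-assoc _ a y ⟨
    (inv a a≉0 * a) * y     ≈⟨ *-congʳ (*-inverseˡ a a≉0) ⟩
    1# * y                  ≈⟨ *-identityˡ y ⟩
    y                       ∎

  *-cancelʳ : ∀ {a x y} → a ≉ 0# → x * a ≈ y * a → x ≈ y
  *-cancelʳ a≉0 xa≈ya = *-cancelˡ a≉0 (trans (*-comm _ _) (trans xa≈ya (*-comm _ _)))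

  x*y≈0⇒x≈0⊎y≈0 : ∀ {x y} → x * y ≈ 0# → x ≈ 0# ⊎ y ≈ 0#
  x*y≈0⇒x≈0⊎y≈0 {x} {y} xy≈0 with x ≟ 0#
  ... | yes x≈0 = inj₁ x≈0
  ... | no  x≉0 = inj₂ (*-cancelˡ x≉0 (trans xy≈0 (sym (zeroʳ x))))

  *-≉0 : ∀ {x y} → x ≉ 0# → y ≉ 0# → x * y ≉ 0#
  *-≉0 x≉0 y≉0 xy≈0 = [ x≉0 , y≉0 ]′ (x*y≈0⇒x≈0⊎y≈0 xy≈0)

  ^-≉0 : ∀ {x} n → x ≉ 0# → x ^ n ≉ 0#
  ^-≉0 zero    x≉0 = 1≉0
  ^-≉0 (suc n) x≉0 = *-≉0 x≉0 (^-≉0 n x≉0)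

  ^≈0⇒≈0 : ∀ {x} n → x ^ n ≈ 0# → x ≈ 0#
  ^≈0⇒≈0 {x} n xⁿ≈0 = decidable-stable (x ≟ 0#) (λ x≉0 → ^-≉0 n x≉0 xⁿ≈0)

  private
    reindexing : (u v : Carrier → Carrier) → Congruent _≈_ _≈_ u → Congruent _≈_ _≈_ v →
                 (∀ x → u (v x) ≈ x) → (∀ x → v (u x) ≈ x) →
                 Σ[ π ∈ Permutation N N ] (∀ i → element (π ⟨$⟩ʳ i) ≈ u (element i))
    reindexing u v u-cong v-cong uv vu = π , λ i → element-index _
      where
      π : Permutation N N
      π = permutation (λ i → index (u (element i))) (λ i → index (v (element i)))
            (λ i → element-injective (trans (element-index _) (trans (u-cong (element-index _)) (uv (element i)))))
            (λ i → element-injective (trans (element-index _) (trans (v-cong (element-index _)) (vu (element i)))))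

    module Σ = Algebra.Properties.CommutativeMonoid.Sum +-commutativeMonoid
    module Π = Algebra.Properties.CommutativeMonoid.Sum *-commutativeMonoid

  -- translation by a permutes the elements, so Σ x = Σ (a + x) = N × a + Σ x
  N×a≈0 : ∀ a → N × a ≈ 0#
  N×a≈0 a = trans (sym (×ᵤ≈× N a)) (+-identityˡ-unique _ (Σ.sum element) (sym (begin
    Σ.sum element                          ≈⟨ Σ.sum-permute element π ⟩
    Σ.sum (λ i → element (π ⟨$⟩ʳ i))       ≈⟨ Σ.sum-cong-≋ π-translates ⟩
    Σ.sum (λ i → a + element i)            ≈⟨ Σ.∑-distrib-+ (λ _ → a) element ⟩
    Σ.sum {N} (λ _ → a) + Σ.sum element    ≈⟨ +-congʳ (Σ.sum-replicate N) ⟩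
    _ + Σ.sum element                      ∎)))
    where
    translation = reindexing (λ x → a + x) (λ x → - a + x) +-congˡ +-congˡ
      (λ x → trans (sym (+-assoc _ _ _)) (trans (+-congʳ (-‿inverseʳ a)) (+-identityˡ x)))
      (λ x → trans (sym (+-assoc _ _ _)) (trans (+-congʳ (-‿inverseˡ a)) (+-identityˡ x)))
    π = proj₁ translation
    π-translates = proj₂ translation

  private
    Π-≉0 : ∀ {n} (s : Fin n → Carrier) → (∀ i → s i ≉ 0#) → Π.sum s ≉ 0#
    Π-≉0 {zero}  s s≉0 = 1≉0
    Π-≉0 {suc n} s s≉0 = *-≉0 (s≉0 zero) (Π-≉0 (λ i → s (suc i)) (λ i → s≉0 (suc i)))

    Π-all-but-one : ∀ {n} (s : Fin n → Carrier) x i₀ → s i₀ ≈ 1# → (∀ i → i ≢ i₀ → s i ≈ x) →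
                    Π.sum s ≈ x ^ ℕ.pred n
    Π-all-but-one {suc n} s x i₀ s₀≈1 s≈x = begin
      Π.sum s                              ≈⟨ Π.sum-remove s ⟩
      s i₀ * Π.sum (removeAt s i₀)         ≈⟨ *-cong s₀≈1 (Π.sum-cong-≋ λ j → s≈x _ (Fin.punchInᵢ≢i i₀ j)) ⟩
      1# * Π.sum {n} (λ _ → x)             ≈⟨ *-identityˡ _ ⟩
      Π.sum {n} (λ _ → x)                  ≈⟨ Π.sum-replicate n ⟩
      x Exp.^ n                            ≈⟨ ^≈Exp^ x n ⟨
      x ^ n                                ∎
      where import Algebra.Properties.Semiring.Exp semiring as Exp

    nonzeroPart : Carrier → Carrier
    nonzeroPart g with g ≟ 0#
    ... | yes _ = 1#
    ... | no  _ = g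

    nonzeroPart-≉0 : ∀ g → nonzeroPart g ≉ 0#
    nonzeroPart-≉0 g with g ≟ 0#
    ... | yes _   = 1≉0
    ... | no  g≉0 = g≉0

    nonzeroPart-cong : Congruent _≈_ _≈_ nonzeroPart
    nonzeroPart-cong {g} {h} g≈h with g ≟ 0# | h ≟ 0#
    ... | yes _   | yes _   = refl
    ... | yes g≈0 | no  h≉0 = ⊥-elim (h≉0 (trans (sym g≈h) g≈0))
    ... | no  g≉0 | yes h≈0 = ⊥-elim (g≉0 (trans g≈h h≈0))
    ... | no  _   | no  _   = g≈h

    module Scaling (x : Carrier) (x≉0 : x ≉ 0#) where
      multiplier : Carrier → Carrier
      multiplier g with g ≟ 0#
      ... | yes _ = 1#
      ... | no  _ = x

      nonzeroPart-scaled : ∀ g → nonzeroPart (x * g) ≈ multiplier g * nonzeroPart g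
      nonzeroPart-scaled g with g ≟ 0# | x * g ≟ 0#
      ... | yes _   | yes _    = sym (*-identityˡ 1#)
      ... | yes g≈0 | no  xg≉0 = ⊥-elim (xg≉0 (trans (*-congˡ g≈0) (zeroʳ x)))
      ... | no  g≉0 | yes xg≈0 = ⊥-elim (*-≉0 x≉0 g≉0 xg≈0)
      ... | no  _   | no  _    = refl

      multiplier-0 : multiplier (element (index 0#)) ≈ 1#
      multiplier-0 with element (index 0#) ≟ 0#
      ... | yes _ = refl
      ... | no  e≉0 = ⊥-elim (e≉0 (element-index 0#))

      multiplier-≉0 : ∀ i → i ≢ index 0# → multiplier (element i) ≈ x
      multiplier-≉0 i i≢i₀ with element i ≟ 0#
      ... | yes eᵢ≈0 = ⊥-elim (i≢i₀ (element-injective (trans eᵢ≈0 (sym (element-index 0#)))))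
      ... | no  _    = refl

  -- multiplication by x permutes the nonzero elements, so their product P satisfies P = x ^ (N - 1) * P
  x^[N-1]≈1 : ∀ {x} → x ≉ 0# → x ^ ℕ.pred N ≈ 1#
  x^[N-1]≈1 {x} x≉0 = *-cancelʳ (Π-≉0 nonzeros (λ i → nonzeroPart-≉0 (element i))) (begin
    x ^ ℕ.pred N * P             ≈⟨ *-congʳ (Π-all-but-one multipliers x (index 0#) multiplier-0 multiplier-≉0) ⟨
    Π.sum multipliers * P        ≈⟨ Π.∑-distrib-+ multipliers nonzeros ⟨
    Π.sum (λ i → multipliers i * nonzeros i)
      ≈⟨ Π.sum-cong-≋ (λ i → trans (nonzeroPart-cong (π-scales i)) (nonzeroPart-scaled (element i))) ⟨
    Π.sum (λ i → nonzeros (π ⟨$⟩ʳ i))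
      ≈⟨ Π.sum-permute nonzeros π ⟨
    P                            ≈⟨ *-identityˡ P ⟨
    1# * P                       ∎)
    where
    open Scaling x x≉0
    nonzeros multipliers : Fin N → Carrier
    nonzeros i = nonzeroPart (element i)
    multipliers i = multiplier (element i)
    P = Π.sum nonzeros
    scaling = reindexing (x *_) (inv x x≉0 *_) *-congˡ *-congˡ
      (λ y → trans (sym (*-assoc _ _ _)) (trans (*-congʳ (*-inverseʳ x x≉0)) (*-identityˡ y)))
      (λ y → trans (sym (*-assoc _ _ _)) (trans (*-congʳ (*-inverseˡ x x≉0)) (*-identityˡ y)))
    π = proj₁ scaling
    π-scales = proj₂ scaling

  x^N≈x : ∀ x → x ^ N ≈ x
  x^N≈x x = trans (reflexive (≡.cong (x ^_) (≡.sym (ℕ.suc-pred N ⦃ Fin.nonZeroIndex (index x) ⦄))))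
                  (x*x^[N-1]≈x (x ≟ 0#))
    where
    x*x^[N-1]≈x : Dec (x ≈ 0#) → x * x ^ ℕ.pred N ≈ x
    x*x^[N-1]≈x (yes x≈0) = trans (*-congʳ x≈0) (trans (zeroˡ _) (sym x≈0))
    x*x^[N-1]≈x (no  x≉0) = trans (*-congˡ (x^[N-1]≈1 x≉0)) (*-identityʳ x)

  injective⇒bijective : ∀ {f} → Congruent _≈_ _≈_ f → Injective _≈_ _≈_ f → Bijective _≈_ _≈_ f
  injective⇒bijective {f} f-cong f-injective = f-injective , λ y →
    let i , gi≡y = Fin-injective⇒surjective g g-injective (index y) in
    element i , λ z≈ → trans (f-cong z≈) (trans (sym (element-index _))
                                 (trans (reflexive (≡.cong element gi≡y)) (element-index y)))
    where
    g : Fin N → Fin N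
    g i = index (f (element i))
    g-injective : Injective _≡_ _≡_ g
    g-injective gi≡gj = element-injective (f-injective
      (trans (sym (element-index _)) (trans (reflexive (≡.cong element gi≡gj)) (element-index _))))

  open PolynomialFunctions F

  Poly-roots≤ : ∀ {n a f} → a ≉ 0# → Poly n a f → ∀ {m} (r : Fin m → Carrier) →
                Injective _≡_ _≈_ r → (∀ i → f (r i) ≈ 0#) → m ≤ n
  Poly-roots≤ a≉0 pf            {zero}  r r-injective roots = z≤n
  Poly-roots≤ a≉0 (constant f≈a) {suc m} r r-injective roots = ⊥-elim (a≉0 (trans (sym (f≈a (r zero))) (roots zero)))
  Poly-roots≤ a≉0 (factor pf)   {suc m} r r-injective roots =
    s≤s (Poly-roots≤ a≉0 pg (r ∘ suc) (Fin.suc-injective ∘ r-injective) g-roots)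
    where
    g = proj₁ (pf (r zero))
    pg = proj₁ (proj₂ (pf (r zero)))
    f≈ = proj₂ (proj₂ (pf (r zero)))
    g-roots : ∀ i → g (r (suc i)) ≈ 0#
    g-roots i with x*y≈0⇒x≈0⊎y≈0 (trans (sym (trans (f≈ (r (suc i))) (trans (+-congʳ (roots zero)) (+-identityˡ _))))
                                       (roots (suc i)))
    ... | inj₁ rᵢ-r₀≈0 with () ← r-injective (x∙y⁻¹≈ε⇒x≈y _ _ rᵢ-r₀≈0)
    ... | inj₂ g≈0 = g≈0

  Poly-nonRoot : ∀ {n a f} → a ≉ 0# → Poly n a f → n < N → ∃ λ x → f x ≉ 0#
  Poly-nonRoot {f = f} a≉0 pf n<N with Fin.any? (λ i → ¬? (f (element i) ≟ 0#))
  ... | yes (i , fᵢ≉0) = element i , fᵢ≉0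
  ... | no  none = ⊥-elim (ℕ.<⇒≱ n<N (Poly-roots≤ a≉0 pf element element-injective
                     (λ i → decidable-stable (f (element i) ≟ 0#) (λ fᵢ≉0 → none (i , fᵢ≉0)))))

module Frobenius {c ℓ : Level} (F : CommutativeRing c ℓ) {q p k : ℕ} (p-prime : Prime p) (k≥1 : 1 ≤ k)
                 (q≡p^k : q ≡ p ℕ.^ k) (F-finite : IsFiniteFieldOfOrder F (q ℕ.* q)) where
  open CommutativeRing F hiding (zero)
  open IsFiniteFieldOfOrder F-finite using (1≉0)
  open Powers F
  open Characteristic F
  open FiniteField F F-finite
  open Algebra.Properties.Semiring.Mult.TCOptimised semiring using (_×_; ×1-homo-*)
  open Algebra.Properties.Ring ring using (x+x≈x⇒x≈0; +-inverseʳ-unique)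

  p∣q : p ∣ q
  p∣q = ≡.subst (p ∣_) (≡.sym q≡p^k) (p∣p^ k≥1)
    where
    p∣p^ : ∀ {j} → 1 ≤ j → p ∣ p ℕ.^ j
    p∣p^ {suc j} _ = m∣m*n (p ℕ.^ j)

  2≤q : 2 ≤ q
  2≤q = ℕ.≤-trans (ℕ.nonTrivial⇒n>1 p ⦃ prime⇒nonTrivial p-prime ⦄) (∣⇒≤ ⦃ q≢0 ⦄ p∣q)
    where
    q≢0 : ℕ.NonZero q
    q≢0 = ≡.subst ℕ.NonZero (≡.sym q≡p^k) (ℕ.m^n≢0 p k ⦃ prime⇒nonZero p-prime ⦄)

  q×1≈0 : q × 1# ≈ 0#
  q×1≈0 = reduce (x*y≈0⇒x≈0⊎y≈0 (trans (sym (×1-homo-* q q)) (N×a≈0 1#)))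

  p×1≈0 : p × 1# ≈ 0#
  p×1≈0 = ^≈0⇒≈0 k (trans (sym (×1-homo-^ p k)) (trans (reflexive (≡.cong (_× 1#) (≡.sym q≡p^k))) q×1≈0))

  prime∣q⇒×1≈0 : ∀ {d} → Prime d → d ∣ q → d × 1# ≈ 0#
  prime∣q⇒×1≈0 d-prime d∣q with prime⇒irreducible p-prime (prime∣^⇒∣ k d-prime (≡.subst (_ ∣_) q≡p^k d∣q))
  ... | inj₁ ≡.refl with () ← prime⇒nonTrivial d-prime
  ... | inj₂ ≡.refl = p×1≈0

  prime∤q⇒×1≉0 : ∀ {d} → Prime d → ¬ d ∣ q → d × 1# ≉ 0#
  prime∤q⇒×1≉0 {d} d-prime d∤q d×1≈0 = 1≉0 (coprime⇒1≈0 p×1≈0 p-coprime-d d×1≈0)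
    where
    p-coprime-d : Coprime p d
    p-coprime-d (e∣p , e∣d) with prime⇒irreducible p-prime e∣p
    ... | inj₁ e≡1 = e≡1
    ... | inj₂ ≡.refl with prime⇒irreducible d-prime e∣d
    ...   | inj₁ ≡.refl with () ← prime⇒nonTrivial p-prime
    ...   | inj₂ ≡.refl = ⊥-elim (d∤q p∣q)

  σ : Carrier → Carrier
  σ x = x ^ q

  σ-cong : ∀ {x y} → x ≈ y → σ x ≈ σ y
  σ-cong = ^-congˡ q

  σ-+ : ∀ x y → σ (x + y) ≈ σ x + σ y
  σ-+ x y = ≡.subst (λ n → (x + y) ^ n ≈ x ^ n + y ^ n) (≡.sym q≡p^k) (frobenius-^ p-prime p×1≈0 k x y)

  σ-* : ∀ x y → σ (x * y) ≈ σ x * σ y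
  σ-* x y = ^-distrib-* x y q

  σ-1 : σ 1# ≈ 1#
  σ-1 = 1^n≈1 q

  σ-0 : σ 0# ≈ 0#
  σ-0 = x+x≈x⇒x≈0 (σ 0#) (trans (sym (σ-+ 0# 0#)) (σ-cong (+-identityʳ 0#)))

  σ-‿ : ∀ x → σ (- x) ≈ - σ x
  σ-‿ x = +-inverseʳ-unique (σ x) (σ (- x)) (trans (sym (σ-+ x (- x))) (trans (σ-cong (-‿inverseʳ x)) σ-0))

  σ-- : ∀ x y → σ (x - y) ≈ σ x - σ y
  σ-- x y = trans (σ-+ x (- y)) (+-congˡ (σ-‿ y))

  σ-involutive : ∀ x → σ (σ x) ≈ x
  σ-involutive x = trans (^-assocʳ x q q) (x^N≈x x)

  σ-^ : ∀ x n → σ (x ^ n) ≈ σ x ^ n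
  σ-^ x n = trans (^-assocʳ x n q) (trans (reflexive (≡.cong (x ^_) (ℕ.*-comm n q))) (sym (^-assocʳ x q n)))

  σ-×1 : ∀ n → σ (n × 1#) ≈ n × 1#
  σ-×1 0             = σ-0
  σ-×1 1             = σ-1
  σ-×1 (suc (suc n)) = trans (σ-+ (suc n × 1#) 1#) (+-cong (σ-×1 (suc n)) σ-1)

module QuadraticExtension {c ℓ : Level} (F : CommutativeRing c ℓ) {q p k : ℕ} (p-prime : Prime p) (k≥1 : 1 ≤ k)
                          (q≡p^k : q ≡ p ℕ.^ k) (F-finite : IsFiniteFieldOfOrder F (q ℕ.* q)) where
  open import Data.Product using (_×_)
  open CommutativeRing F hiding (zero)
  open IsFiniteFieldOfOrder F-finite using (1≉0)
  open Powers F
  open FiniteField F F-finite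
  open PolynomialFunctions F
  open Frobenius F p-prime k≥1 q≡p^k F-finite
  open IntegerCoefficients F using (module RingSolver; 3#)
  open Algebra.Properties.Ring ring
    using (x∙y⁻¹≈ε⇒x≈y; x≈y⇒x∙y⁻¹≈ε; ⁻¹-anti-homo‿-; -‿involutive; -‿injective; -0#≈0#;
           -‿distribˡ-*; -‿distribʳ-*; -‿+-comm; x[y-z]≈xy-xz)
  open import Algebra.Properties.CommutativeSemigroup *-commutativeSemigroup using (x∙yz≈y∙xz)
  open import Relation.Binary.Reasoning.Setoid setoid

  Fixed : Carrier → Set ℓ
  Fixed x = σ x ≈ x

  Traceless : Carrier → Set ℓ
  Traceless x = σ x ≈ - x

  Fixed-+ : ∀ {x y} → Fixed x → Fixed y → Fixed (x + y)
  Fixed-+ {x} {y} σx≈x σy≈y = trans (σ-+ x y) (+-cong σx≈x σy≈y)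

  Fixed-‿ : ∀ {x} → Fixed x → Fixed (- x)
  Fixed-‿ {x} σx≈x = trans (σ-‿ x) (-‿cong σx≈x)

  Fixed-^ : ∀ {x} n → Fixed x → Fixed (x ^ n)
  Fixed-^ {x} n σx≈x = trans (σ-^ x n) (^-congˡ n σx≈x)

  Fixed-* : ∀ {x y} → Fixed x → Fixed y → Fixed (x * y)
  Fixed-* {x} {y} σx≈x σy≈y = trans (σ-* x y) (*-cong σx≈x σy≈y)

  Fixed-inv : ∀ {x} (x≉0 : x ≉ 0#) → Fixed x → Fixed (inv x x≉0)
  Fixed-inv {x} x≉0 σx≈x = *-cancelˡ x≉0 (begin
    x * σ (inv x x≉0)      ≈⟨ *-congʳ σx≈x ⟨
    σ x * σ (inv x x≉0)    ≈⟨ σ-* x _ ⟨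
    σ (x * inv x x≉0)      ≈⟨ σ-cong (*-inverseʳ x x≉0) ⟩
    σ 1#                   ≈⟨ σ-1 ⟩
    1#                     ≈⟨ *-inverseʳ x x≉0 ⟨
    x * inv x x≉0          ∎)

  Traceless-+ : ∀ {x y} → Traceless x → Traceless y → Traceless (x + y)
  Traceless-+ {x} {y} σx≈-x σy≈-y = trans (σ-+ x y) (trans (+-cong σx≈-x σy≈-y) (-‿+-comm x y))

  Traceless-‿ : ∀ {x} → Traceless x → Traceless (- x)
  Traceless-‿ {x} σx≈-x = trans (σ-‿ x) (-‿cong σx≈-x)

  Fixed-*-Traceless : ∀ {x y} → Fixed x → Traceless y → Traceless (x * y)
  Fixed-*-Traceless {x} {y} σx≈x σy≈-y = trans (σ-* x y) (trans (*-cong σx≈x σy≈-y) (sym (-‿distribʳ-* x y)))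

  Traceless-*-Fixed : ∀ {x y} → Traceless x → Fixed y → Traceless (x * y)
  Traceless-*-Fixed {x} {y} σx≈-x σy≈y =
    trans (σ-cong (*-comm x y)) (trans (Fixed-*-Traceless σy≈y σx≈-x) (-‿cong (*-comm y x)))

  Traceless-* : ∀ {x y} → Traceless x → Traceless y → Fixed (x * y)
  Traceless-* {x} {y} σx≈-x σy≈-y = begin
    σ (x * y)       ≈⟨ σ-* x y ⟩
    σ x * σ y       ≈⟨ *-cong σx≈-x σy≈-y ⟩
    - x * - y       ≈⟨ -‿distribˡ-* x (- y) ⟨
    - (x * - y)     ≈⟨ -‿cong (-‿distribʳ-* x y) ⟨
    - - (x * y)     ≈⟨ -‿involutive (x * y) ⟩
    x * y           ∎

  Traceless-inv : ∀ {x} (x≉0 : x ≉ 0#) → Traceless x → Traceless (inv x x≉0)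
  Traceless-inv {x} x≉0 σx≈-x = *-cancelˡ x≉0 (begin
    x * σ (inv x x≉0)        ≈⟨ -‿involutive _ ⟨
    - - (x * σ (inv x x≉0))  ≈⟨ -‿cong (-‿distribˡ-* x _) ⟩
    - (- x * σ (inv x x≉0))  ≈⟨ -‿cong (*-congʳ σx≈-x) ⟨
    - (σ x * σ (inv x x≉0))  ≈⟨ -‿cong (σ-* x _) ⟨
    - σ (x * inv x x≉0)      ≈⟨ -‿cong (trans (σ-cong (*-inverseʳ x x≉0)) σ-1) ⟩
    - 1#                     ≈⟨ -‿cong (*-inverseʳ x x≉0) ⟨
    - (x * inv x x≉0)        ≈⟨ -‿distribʳ-* x _ ⟩
    x * - inv x x≉0          ∎)

  σx-x-traceless : ∀ x → Traceless (σ x - x)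
  σx-x-traceless x = begin
    σ (σ x - x)      ≈⟨ σ-- (σ x) x ⟩
    σ (σ x) - σ x    ≈⟨ +-congʳ (σ-involutive x) ⟩
    x - σ x          ≈⟨ ⁻¹-anti-homo‿- (σ x) x ⟨
    - (σ x - x)      ∎

  traceless-nonzero : ∃ λ ω → Traceless ω × ω ≉ 0#
  traceless-nonzero =
    let x , σx-x≉0 = Poly-nonRoot 1≉0 (Poly-+-lower (Poly-^ q) (Poly-raise 2≤q Poly-‿x)) q<q*q
    in σ x - x , σx-x-traceless x , σx-x≉0
    where
    q<q*q : q < q ℕ.* q
    q<q*q = ℕ.m<m*n q q ⦃ ℕ.>-nonZero (ℕ.≤-trans (s≤s z≤n) 2≤q) ⦄ 2≤q

  private
    cube-identity : ∀ z → (z - 1#) * (z * z + z + 1#) ≈ z ^ 3 - 1#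
    cube-identity = solve 1 (λ z → (z :- con (ℤ.+ 1)) :* (z :* z :+ z :+ con (ℤ.+ 1)) := z :^ 3 :- con (ℤ.+ 1)) refl
      where open RingSolver

  ζ²+ζ+1≈0⇒ζ³≈1 : ∀ {ζ} → ζ * ζ + ζ + 1# ≈ 0# → ζ ^ 3 ≈ 1#
  ζ²+ζ+1≈0⇒ζ³≈1 {ζ} ζ²+ζ+1≈0 =
    x∙y⁻¹≈ε⇒x≈y _ _ (trans (sym (cube-identity ζ)) (trans (*-congˡ ζ²+ζ+1≈0) (zeroʳ _)))

  cube-root : ¬ 3 ∣ q → ∃ λ ζ → ζ * ζ + ζ + 1# ≈ 0#
  cube-root 3∤q = root (Poly-nonRoot 1≉0 (Poly-+-lower (Poly-^ (suc m)) (Poly-raise (s≤s 1≤m) Poly-‿x)) 1+m<q*q)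
    where
    m = (q ℕ.* q) / 3
    q*q≡1+m*3 : q ℕ.* q ≡ suc (m ℕ.* 3)
    q*q≡1+m*3 = ≡.trans (m≡m%n+[m/n]*n (q ℕ.* q) 3) (≡.cong (ℕ._+ m ℕ.* 3) (n*n%3≡1 q 3∤q))
    1≤m : 1 ≤ m
    1≤m = ℕ.n≢0⇒n>0 λ m≡0 → ℕ.<⇒≱ (ℕ.*-mono-≤ 2≤q 2≤q)
      (ℕ.≤-trans (ℕ.≤-reflexive (≡.trans q*q≡1+m*3 (≡.cong (λ j → suc (j ℕ.* 3)) m≡0))) (s≤s z≤n))
    1+m<q*q : suc m < q ℕ.* q
    1+m<q*q = ≡.subst (suc m <_) (≡.sym q*q≡1+m*3) (s≤s (ℕ.m<m*n m 3 ⦃ ℕ.>-nonZero 1≤m ⦄ (s≤s (s≤s z≤n))))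
    root : (∃ λ x → x ^ suc m - x ≉ 0#) → ∃ λ ζ → ζ * ζ + ζ + 1# ≈ 0#
    root (x , x^[1+m]-x≉0) =
      ζ , [ ⊥-elim ∘ ζ-1≉0 , id ]′ (x*y≈0⇒x≈0⊎y≈0 (trans (cube-identity ζ) ζ³-1≈0))
      where
      ζ = x ^ m
      x≉0 : x ≉ 0#
      x≉0 x≈0 = x^[1+m]-x≉0
        (trans (+-cong (trans (*-congʳ x≈0) (zeroˡ _)) (-‿cong x≈0)) (trans (+-identityˡ _) -0#≈0#))
      ζ-1≉0 : ζ - 1# ≉ 0#
      ζ-1≉0 ζ-1≈0 = x^[1+m]-x≉0
        (x≈y⇒x∙y⁻¹≈ε (trans (*-congˡ (x∙y⁻¹≈ε⇒x≈y ζ 1# ζ-1≈0)) (*-identityʳ x)))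
      ζ³-1≈0 : ζ ^ 3 - 1# ≈ 0#
      ζ³-1≈0 = x≈y⇒x∙y⁻¹≈ε (trans (^-assocʳ x m 3)
        (trans (reflexive (≡.cong (λ j → x ^ ℕ.pred j) (≡.sym q*q≡1+m*3))) (x^[N-1]≈1 x≉0)))

  -- C r x = ((x^(q+1))^(q-1) - b^(q-1)) / (x^(q+1) - b) has degree (q+1)(q-2), so x * C r x has a non-root x;
  -- since (x^(q+1))^(q-1) = 1 = b^(q-1), that x satisfies x^(q+1) = b
  norm-onto : ∀ {b} → Fixed b → b ≉ 0# → ∃ λ L → L * σ L ≈ b
  norm-onto {b} σb≈b b≉0 = root (Poly-nonRoot 1≉0 (Poly-x* (Poly-C r)) (1+[q-2][q+1]<q*q q 2≤q))
    where
    r = q ℕ.∸ 2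
    C : ℕ → Carrier → Carrier
    C zero    x = 1#
    C (suc j) x = x ^ suc q * C j x + b ^ suc j

    Poly-C : ∀ j → Poly (j ℕ.* suc q) 1# (C j)
    Poly-C zero    = constant (λ _ → refl)
    Poly-C (suc j) = Poly-+-lower (Poly-^* (suc q) (Poly-C j)) (Poly-raise (s≤s z≤n) (constant (λ _ → refl)))

    C-telescopes : ∀ j x → (x ^ suc q - b) * C j x ≈ (x ^ suc q) ^ suc j - b ^ suc j
    C-telescopes zero    x = identity₀ (x ^ suc q) b
      where
      open RingSolver
      identity₀ : ∀ y b → (y - b) * 1# ≈ y * 1# - b * 1#
      identity₀ = solve 2 (λ y b → (y :- b) :* con (ℤ.+ 1) := y :* con (ℤ.+ 1) :- b :* con (ℤ.+ 1)) refl
    C-telescopes (suc j) x = begin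
      (y - b) * (y * C j x + b ^ suc j)                     ≈⟨ identity₁ y b (C j x) (b ^ suc j) ⟩
      y * ((y - b) * C j x) + (y - b) * b ^ suc j           ≈⟨ +-congʳ (*-congˡ (C-telescopes j x)) ⟩
      y * (y ^ suc j - b ^ suc j) + (y - b) * b ^ suc j     ≈⟨ identity₂ y b (y ^ suc j) (b ^ suc j) ⟩
      y * y ^ suc j - b * b ^ suc j                         ∎
      where
      y = x ^ suc q
      open RingSolver
      identity₁ : ∀ y b c d → (y - b) * (y * c + d) ≈ y * ((y - b) * c) + (y - b) * d
      identity₁ = solve 4 (λ y b c d → (y :- b) :* (y :* c :+ d) := y :* ((y :- b) :* c) :+ (y :- b) :* d) refl
      identity₂ : ∀ y b yʲ bʲ → y * (yʲ - bʲ) + (y - b) * bʲ ≈ y * yʲ - b * bʲ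
      identity₂ = solve 4 (λ y b yʲ bʲ → y :* (yʲ :- bʲ) :+ (y :- b) :* bʲ := y :* yʲ :- b :* bʲ) refl

    b^[q-1]≈1 : b ^ suc r ≈ 1#
    b^[q-1]≈1 = *-cancelˡ b≉0 (begin
      b ^ suc (suc r)    ≡⟨ ≡.cong (b ^_) (ℕ.m+[n∸m]≡n 2≤q) ⟩
      σ b                ≈⟨ σb≈b ⟩
      b                  ≈⟨ *-identityʳ b ⟨
      b * 1#             ∎)

    root : (∃ λ x → x * C r x ≉ 0#) → ∃ λ L → L * σ L ≈ b
    root (x , xC≉0) = x , x∙y⁻¹≈ε⇒x≈y _ _ ([ id , ⊥-elim ∘ C≉0 ]′
      (x*y≈0⇒x≈0⊎y≈0 (trans (C-telescopes r x) (x≈y⇒x∙y⁻¹≈ε (trans x^[q+1][q-1]≈1 (sym b^[q-1]≈1))))))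
      where
      x≉0 : x ≉ 0#
      x≉0 x≈0 = xC≉0 (trans (*-congʳ x≈0) (zeroˡ _))
      C≉0 : C r x ≉ 0#
      C≉0 C≈0 = xC≉0 (trans (*-congˡ C≈0) (zeroʳ x))
      x^[q+1][q-1]≈1 : (x ^ suc q) ^ suc r ≈ 1#
      x^[q+1][q-1]≈1 = trans (^-assocʳ x (suc q) (suc r))
        (trans (reflexive (≡.cong (x ^_) ([q+1][q-1]≡q*q-1 q 2≤q))) (x^[N-1]≈1 x≉0))

  Q : Carrier → Carrier → Carrier
  Q a b = a * a + a * b + b * b

  Q-Represents : Carrier → Set (c ⊔ ℓ)
  Q-Represents e = ∃ λ s₁ → ∃ λ s₂ → Traceless s₁ × Traceless s₂ × s₁ ≉ s₂ × Q s₁ s₂ ≈ e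

  Q-Represents-cong : ∀ {e e′} → e ≈ e′ → Q-Represents e → Q-Represents e′
  Q-Represents-cong e≈e′ (s₁ , s₂ , σs₁ , σs₂ , s₁≉s₂ , Q≈e) = s₁ , s₂ , σs₁ , σs₂ , s₁≉s₂ , trans Q≈e e≈e′

  3≉0 : ¬ 3 ∣ q → 3# ≉ 0#
  3≉0 = prime∤q⇒×1≉0 prime[3]

  Q≈0⇒≈ : q % 3 ≡ 2 → ∀ {s₁ s₂} → Traceless s₁ → Traceless s₂ → Q s₁ s₂ ≈ 0# → s₁ ≈ s₂
  Q≈0⇒≈ q%3≡2 {s₁} {s₂} σs₁ σs₂ Q≈0 with s₂ ≟ 0#
  ... | yes s₂≈0 = trans s₁≈0 (sym s₂≈0)
    where
    s₁≈0 : s₁ ≈ 0#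
    s₁≈0 = reduce (x*y≈0⇒x≈0⊎y≈0 (trans (sym (Q-at-0 s₁ s₂ s₂≈0)) Q≈0))
      where
      Q-at-0 : ∀ a b → b ≈ 0# → Q a b ≈ a * a
      Q-at-0 a b b≈0 = trans (+-cong (+-congˡ (trans (*-congˡ b≈0) (zeroʳ a))) (trans (*-congˡ b≈0) (zeroʳ b)))
                             (trans (+-identityʳ _) (+-identityʳ _))
  ... | no s₂≉0 = [ ⊥-elim ∘ w≉0 , w-1≈0⇒s₁≈s₂ ]′ (x*y≈0⇒x≈0⊎y≈0 (trans (identity₂ w) (x≈y⇒x∙y⁻¹≈ε w²≈w)))
    where
    open RingSolver
    identity₁ : ∀ a b → a ^ 3 - b ^ 3 ≈ (a - b) * Q a b
    identity₁ = solve 2 (λ a b → a :^ 3 :- b :^ 3 := (a :- b) :* (a :* a :+ a :* b :+ b :* b)) refl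
    identity₂ : ∀ w → w * (w - 1#) ≈ w ^ 2 - w
    identity₂ = solve 1 (λ w → w :* (w :- con (ℤ.+ 1)) := w :^ 2 :- w) refl
    w = s₁ * inv s₂ s₂≉0
    ws₂≈s₁ : w * s₂ ≈ s₁
    ws₂≈s₁ = trans (*-assoc _ _ _) (trans (*-congˡ (*-inverseˡ s₂ s₂≉0)) (*-identityʳ s₁))
    s₁³≈s₂³ : s₁ ^ 3 ≈ s₂ ^ 3
    s₁³≈s₂³ = x∙y⁻¹≈ε⇒x≈y _ _ (trans (identity₁ s₁ s₂) (trans (*-congˡ Q≈0) (zeroʳ _)))
    w³≈1 : w ^ 3 ≈ 1#
    w³≈1 = *-cancelʳ (^-≉0 3 s₂≉0) (begin
      w ^ 3 * s₂ ^ 3     ≈⟨ ^-distrib-* w s₂ 3 ⟨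
      (w * s₂) ^ 3       ≈⟨ ^-congˡ 3 ws₂≈s₁ ⟩
      s₁ ^ 3             ≈⟨ s₁³≈s₂³ ⟩
      s₂ ^ 3             ≈⟨ *-identityˡ _ ⟨
      1# * s₂ ^ 3        ∎)
    w²≈w : w ^ 2 ≈ w
    w²≈w = begin
      w ^ 2              ≡⟨ ≡.cong (w ^_) q%3≡2 ⟨
      w ^ (q % 3)        ≈⟨ ^-mod 3 q w³≈1 ⟨
      σ w                ≈⟨ Traceless-* σs₁ (Traceless-inv s₂≉0 σs₂) ⟩
      w                  ∎
    w≉0 : w ≉ 0#
    w≉0 w≈0 = s₂≉0 (^≈0⇒≈0 3 (trans (sym s₁³≈s₂³) (trans (^-congˡ 3 s₁≈0) (zeroˡ _))))
      where
      s₁≈0 : s₁ ≈ 0#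
      s₁≈0 = trans (sym ws₂≈s₁) (trans (*-congʳ w≈0) (zeroˡ s₂))
    w-1≈0⇒s₁≈s₂ : w - 1# ≈ 0# → s₁ ≈ s₂
    w-1≈0⇒s₁≈s₂ w-1≈0 = trans (sym ws₂≈s₁) (trans (*-congʳ (x∙y⁻¹≈ε⇒x≈y _ _ w-1≈0)) (*-identityˡ s₂))

  private
    ζ-Fixed : q % 3 ≡ 1 → ∀ {ζ} → ζ * ζ + ζ + 1# ≈ 0# → Fixed ζ
    ζ-Fixed q%3≡1 {ζ} ζ²+ζ+1≈0 =
      trans (^-mod 3 q (ζ²+ζ+1≈0⇒ζ³≈1 ζ²+ζ+1≈0)) (trans (reflexive (≡.cong (ζ ^_) q%3≡1)) (*-identityʳ ζ))

    ζ≉1 : ¬ 3 ∣ q → ∀ {ζ} → ζ * ζ + ζ + 1# ≈ 0# → ζ ≉ 1#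
    ζ≉1 3∤q {ζ} ζ²+ζ+1≈0 ζ≈1 =
      3≉0 3∤q (trans (sym (+-congʳ (+-cong (trans (*-cong ζ≈1 ζ≈1) (*-identityˡ 1#)) ζ≈1))) ζ²+ζ+1≈0)

  Q-represents-0 : q % 3 ≡ 1 → Q-Represents 0#
  Q-represents-0 q%3≡1 =
    ω , ζ * ω , σω≈-ω , Fixed-*-Traceless (ζ-Fixed q%3≡1 ζ²+ζ+1≈0) σω≈-ω , ω≉ζω , Q-ω-ζω
    where
    ω = proj₁ traceless-nonzero
    σω≈-ω = proj₁ (proj₂ traceless-nonzero)
    ω≉0 = proj₂ (proj₂ traceless-nonzero)
    3∤q = n%3≡1+r⇒3∤n q%3≡1
    ζ = proj₁ (cube-root 3∤q)
    ζ²+ζ+1≈0 = proj₂ (cube-root 3∤q)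
    ω≉ζω : ω ≉ ζ * ω
    ω≉ζω ω≈ζω = ζ≉1 3∤q ζ²+ζ+1≈0 (sym (*-cancelʳ ω≉0 (trans (*-identityˡ ω) ω≈ζω)))
    Q-ω-ζω : Q ω (ζ * ω) ≈ 0#
    Q-ω-ζω = trans (identity ω ζ) (trans (*-congˡ ζ²+ζ+1≈0) (zeroʳ _))
      where
      open RingSolver
      identity : ∀ w z → Q w (z * w) ≈ (w * w) * (z * z + z + 1#)
      identity = solve 2 (λ w z → w :* w :+ w :* (z :* w) :+ (z :* w) :* (z :* w)
                               := (w :* w) :* (z :* z :+ z :+ con (ℤ.+ 1))) refl

  private
    -- if z₁ = z₂, the pair (z₁, -2 z₁) gives the same value 3 z₁² and is distinct as 3 z₁ ≠ 0
    distinct-pair : ¬ 3 ∣ q → ∀ {e z₁ z₂} → e ≉ 0# → Traceless z₁ → Traceless z₂ → Q z₁ z₂ ≈ e →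
                    Q-Represents e
    distinct-pair 3∤q {e} {z₁} {z₂} e≉0 σz₁ σz₂ Q≈e with z₁ ≟ z₂
    ... | no  z₁≉z₂ = z₁ , z₂ , σz₁ , σz₂ , z₁≉z₂ , Q≈e
    ... | yes z₁≈z₂ =
      z₁ , - (z₁ + z₁) , σz₁ , Traceless-‿ (Traceless-+ σz₁ σz₁) , z₁≉-2z₁ , trans (identity₁ z₁) Qz₁z₁≈e
      where
      open RingSolver
      identity₁ : ∀ z → Q z (- (z + z)) ≈ Q z z
      identity₁ = solve 1 (λ z → z :* z :+ z :* :- (z :+ z) :+ :- (z :+ z) :* :- (z :+ z)
                              := z :* z :+ z :* z :+ z :* z) refl
      identity₂ : ∀ z → 3# * z ≈ z - - (z + z)
      identity₂ = solve 1 (λ z → con (ℤ.+ 3) :* z := z :- :- (z :+ z)) refl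
      identity₃ : ∀ z → Q z z ≈ z * (3# * z)
      identity₃ = solve 1 (λ z → z :* z :+ z :* z :+ z :* z := z :* (con (ℤ.+ 3) :* z)) refl
      Qz₁z₁≈e : Q z₁ z₁ ≈ e
      Qz₁z₁≈e = trans (+-cong (+-congˡ (*-congˡ z₁≈z₂)) (*-cong z₁≈z₂ z₁≈z₂)) Q≈e
      z₁≉-2z₁ : z₁ ≉ - (z₁ + z₁)
      z₁≉-2z₁ z₁≈-2z₁ = e≉0 (begin
        e                  ≈⟨ Qz₁z₁≈e ⟨
        Q z₁ z₁            ≈⟨ identity₃ z₁ ⟩
        z₁ * (3# * z₁)     ≈⟨ *-congˡ (trans (identity₂ z₁) (x≈y⇒x∙y⁻¹≈ε z₁≈-2z₁)) ⟩
        z₁ * 0#            ≈⟨ zeroʳ z₁ ⟩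
        0#                 ∎)

    module Factorisation {ζ} (ζ²+ζ+1≈0 : ζ * ζ + ζ + 1# ≈ 0#) (ζ²-ζ≉0 : ζ * ζ - ζ ≉ 0#)
                         (L₁ L₂ : Carrier) where
      z₂ = (L₁ - L₂) * inv (ζ * ζ - ζ) ζ²-ζ≉0
      z₁ = L₁ + ζ * z₂

      z₂[ζ²-ζ]≈L₁-L₂ : z₂ * (ζ * ζ - ζ) ≈ L₁ - L₂
      z₂[ζ²-ζ]≈L₁-L₂ = trans (*-assoc _ _ _) (trans (*-congˡ (*-inverseˡ _ ζ²-ζ≉0)) (*-identityʳ _))

      -- Q a b = (a - ζ b) (a - ζ² b), and z₁ - ζ z₂ = L₁, z₁ - ζ² z₂ = L₂
      Q≈L₁L₂ : Q z₁ z₂ ≈ L₁ * L₂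
      Q≈L₁L₂ = begin
        Q z₁ z₂
          ≈⟨ identity₁ L₁ ζ z₂ ⟩
        L₁ * (L₁ - z₂ * (ζ * ζ - ζ)) + (ζ * ζ + ζ + 1#) * ((L₁ + ζ * z₂) * z₂ - (ζ - 1#) * (z₂ * z₂))
          ≈⟨ +-cong (*-congˡ (+-congˡ (-‿cong z₂[ζ²-ζ]≈L₁-L₂))) (trans (*-congʳ ζ²+ζ+1≈0) (zeroˡ _)) ⟩
        L₁ * (L₁ - (L₁ - L₂)) + 0#
          ≈⟨ identity₂ L₁ L₂ ⟩
        L₁ * L₂ ∎
        where
        open RingSolver
        identity₁ : ∀ L ζ z → Q (L + ζ * z) z ≈
                    L * (L - z * (ζ * ζ - ζ)) + (ζ * ζ + ζ + 1#) * ((L + ζ * z) * z - (ζ - 1#) * (z * z))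
        identity₁ = solve 3 (λ L ζ z → (L :+ ζ :* z) :* (L :+ ζ :* z) :+ (L :+ ζ :* z) :* z :+ z :* z
          := L :* (L :- z :* (ζ :* ζ :- ζ))
             :+ (ζ :* ζ :+ ζ :+ con (ℤ.+ 1)) :* ((L :+ ζ :* z) :* z :- (ζ :- con (ℤ.+ 1)) :* (z :* z))) refl
        identity₂ : ∀ a b → a * (a - (a - b)) + 0# ≈ a * b
        identity₂ = solve 2 (λ a b → a :* (a :- (a :- b)) :+ con (ℤ.+ 0) := a :* b) refl

  Q-represents : ¬ 3 ∣ q → ∀ {e} → Fixed e → e ≉ 0# → Q-Represents e
  Q-represents 3∤q {e} σe≈e e≉0 = [ q%3≡1⇒ , q%3≡2⇒ ]′ (n%3≡1⊎n%3≡2 q 3∤q)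
    where
    ζ = proj₁ (cube-root 3∤q)
    ζ²+ζ+1≈0 = proj₂ (cube-root 3∤q)

    ζ≉0 : ζ ≉ 0#
    ζ≉0 ζ≈0 = 1≉0 (trans (sym (trans (+-congʳ (trans (+-cong (trans (*-congˡ ζ≈0) (zeroʳ ζ)) ζ≈0) (+-identityʳ 0#)))
                                      (+-identityˡ 1#))) ζ²+ζ+1≈0)

    ζ²-ζ≉0 : ζ * ζ - ζ ≉ 0#
    ζ²-ζ≉0 ζ²-ζ≈0 = *-≉0 ζ≉0 (ζ≉1 3∤q ζ²+ζ+1≈0 ∘ x∙y⁻¹≈ε⇒x≈y _ _)
      (trans (x[y-z]≈xy-xz ζ ζ 1#) (trans (+-congˡ (-‿cong (*-identityʳ ζ))) ζ²-ζ≈0))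

    q%3≡1⇒ : q % 3 ≡ 1 → Q-Represents e
    q%3≡1⇒ q%3≡1 = distinct-pair 3∤q e≉0 σz₁ σz₂ (trans Q≈L₁L₂ ωL₂≈e)
      where
      ω = proj₁ traceless-nonzero
      σω≈-ω = proj₁ (proj₂ traceless-nonzero)
      ω≉0 = proj₂ (proj₂ traceless-nonzero)
      L₂ = e * inv ω ω≉0
      open Factorisation ζ²+ζ+1≈0 ζ²-ζ≉0 ω L₂
      σζ≈ζ = ζ-Fixed q%3≡1 ζ²+ζ+1≈0
      σz₂ : Traceless z₂
      σz₂ = Traceless-*-Fixed (Traceless-+ σω≈-ω (Traceless-‿ (Fixed-*-Traceless σe≈e (Traceless-inv ω≉0 σω≈-ω))))
                              (Fixed-inv ζ²-ζ≉0 (Fixed-+ (Fixed-* σζ≈ζ σζ≈ζ) (Fixed-‿ σζ≈ζ)))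
      σz₁ : Traceless z₁
      σz₁ = Traceless-+ σω≈-ω (Fixed-*-Traceless σζ≈ζ σz₂)
      ωL₂≈e : ω * L₂ ≈ e
      ωL₂≈e = trans (x∙yz≈y∙xz ω e _) (trans (*-congˡ (*-inverseʳ ω ω≉0)) (*-identityʳ e))

    q%3≡2⇒ : q % 3 ≡ 2 → Q-Represents e
    q%3≡2⇒ q%3≡2 = distinct-pair 3∤q e≉0 σz₁ σz₂ (trans Q≈L₁L₂ L[-σL]≈e)
      where
      norm = norm-onto (Fixed-‿ σe≈e) (λ -e≈0 → e≉0 (-‿injective (trans -e≈0 (sym -0#≈0#))))
      L = proj₁ norm
      open Factorisation ζ²+ζ+1≈0 ζ²-ζ≉0 L (- σ L)
      open RingSolver
      L[-σL]≈e : L * - σ L ≈ e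
      L[-σL]≈e = trans (sym (-‿distribʳ-* L (σ L))) (trans (-‿cong (proj₂ norm)) (-‿involutive e))
      σζ≈ζ² : σ ζ ≈ ζ * ζ
      σζ≈ζ² = trans (^-mod 3 q (ζ²+ζ+1≈0⇒ζ³≈1 ζ²+ζ+1≈0)) (trans (reflexive (≡.cong (ζ ^_) q%3≡2)) (*-congˡ (*-identityʳ ζ)))
      σ[ζ²-ζ] : Traceless (ζ * ζ - ζ)
      σ[ζ²-ζ] = x∙y⁻¹≈ε⇒x≈y _ _ (begin
        σ (ζ * ζ - ζ) - - (ζ * ζ - ζ)
          ≈⟨ +-congʳ (trans (σ-- (ζ * ζ) ζ) (+-cong (trans (σ-* ζ ζ) (*-cong σζ≈ζ² σζ≈ζ²)) (-‿cong σζ≈ζ²))) ⟩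
        ((ζ * ζ) * (ζ * ζ) - ζ * ζ) - - (ζ * ζ - ζ)  ≈⟨ identity ζ ⟩
        (ζ * ζ + ζ + 1#) * (ζ * ζ - ζ)               ≈⟨ trans (*-congʳ ζ²+ζ+1≈0) (zeroˡ _) ⟩
        0#                                           ∎)
        where
        identity : ∀ z → ((z * z) * (z * z) - z * z) - - (z * z - z) ≈ (z * z + z + 1#) * (z * z - z)
        identity = solve 1 (λ z → ((z :* z) :* (z :* z) :- z :* z) :- :- (z :* z :- z)
                               := (z :* z :+ z :+ con (ℤ.+ 1)) :* (z :* z :- z)) refl
      σ[L+σL] : Fixed (L - - σ L)
      σ[L+σL] = trans (σ-- L (- σ L))
        (trans (+-congˡ (-‿cong (trans (σ-‿ (σ L)) (-‿cong (σ-involutive L))))) (identity L (σ L)))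
        where
        identity : ∀ a b → b - - a ≈ a - - b
        identity = solve 2 (λ a b → b :- :- a := a :- :- b) refl
      σz₂ : Traceless z₂
      σz₂ = Fixed-*-Traceless σ[L+σL] (Traceless-inv ζ²-ζ≉0 σ[ζ²-ζ])
      σz₁ : Traceless z₁
      σz₁ = x∙y⁻¹≈ε⇒x≈y _ _ (begin
        σ (L + ζ * z₂) - - (L + ζ * z₂)
          ≈⟨ +-congʳ (trans (σ-+ L _) (+-congˡ (trans (σ-* ζ z₂) (*-cong σζ≈ζ² σz₂)))) ⟩
        (σ L + (ζ * ζ) * - z₂) - - (L + ζ * z₂)  ≈⟨ identity L (σ L) ζ z₂ ⟩
        (L - - σ L) - z₂ * (ζ * ζ - ζ)           ≈⟨ x≈y⇒x∙y⁻¹≈ε (sym z₂[ζ²-ζ]≈L₁-L₂) ⟩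
        0#                                       ∎)
        where
        identity : ∀ L σL z w → (σL + (z * z) * - w) - - (L + z * w) ≈ (L - - σL) - w * (z * z - z)
        identity = solve 4 (λ L σL z w → (σL :+ (z :* z) :* :- w) :- :- (L :+ z :* w)
                                      := (L :- :- σL) :- w :* (z :* z :- z)) refl

module PermutationPolynomial {c ℓ : Level} (F : CommutativeRing c ℓ)
  {q p k : ℕ} (p-prime : Prime p) (k≥1 : 1 ≤ k) (q≡p^k : q ≡ p ℕ.^ k) (q-odd : ¬ 2 ∣ q)
  (F-finite : IsFiniteFieldOfOrder F (q ℕ.* q)) (δ γ : CommutativeRing.Carrier F)
  (γ^q≈γ : CommutativeRing._≈_ F (pow F γ q) γ) (γ≉0 : CommutativeRing._≉_ F γ (CommutativeRing.0# F)) where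
  open import Data.Product using (_×_)
  open CommutativeRing F hiding (zero)
  open Powers F
  open FiniteField F F-finite
  open Frobenius F p-prime k≥1 q≡p^k F-finite
  open QuadraticExtension F p-prime k≥1 q≡p^k F-finite
  open IntegerCoefficients F using (module RingSolver; 2#; 3#)
  open RingSolver using (solve; _:+_; _:-_; :-_; _:*_; _:^_; con; _:=_)
  open Algebra.Properties.Ring ring
    using (x∙y⁻¹≈ε⇒x≈y; x≈y⇒x∙y⁻¹≈ε; +-cancelʳ; +-cancelˡ; -‿injective; -0#≈0#)
  open import Relation.Binary.Reasoning.Setoid setoid

  t : Carrier
  t = δ + σ δ

  y : Carrier → Carrier
  y x = σ x - x + δ

  f : Carrier → Carrier
  f x = y x ^ (2 ℕ.* q ℕ.+ 3) + y x ^ (5 ℕ.* q) + γ * x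

  σt≈t : Fixed t
  σt≈t = trans (σ-+ δ (σ δ)) (trans (+-congˡ (σ-involutive δ)) (+-comm _ _))

  σy≈t-y : ∀ x → σ (y x) ≈ t - y x
  σy≈t-y x = begin
    σ (σ x - x + δ)            ≈⟨ σ-+ _ δ ⟩
    σ (σ x - x) + σ δ          ≈⟨ +-congʳ (σx-x-traceless x) ⟩
    - (σ x - x) + σ δ          ≈⟨ solve 3 (λ w d σd → :- w :+ σd := (d :+ σd) :- (w :+ d)) refl (σ x - x) δ (σ δ) ⟩
    (δ + σ δ) - (σ x - x + δ)  ∎

  y-cong : ∀ {x₁ x₂} → x₁ ≈ x₂ → y x₁ ≈ y x₂
  y-cong x₁≈x₂ = +-congʳ (+-cong (σ-cong x₁≈x₂) (-‿cong x₁≈x₂))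

  f-cong : ∀ {x₁ x₂} → x₁ ≈ x₂ → f x₁ ≈ f x₂
  f-cong x₁≈x₂ = +-cong (+-cong (^-congˡ (2 ℕ.* q ℕ.+ 3) y₁≈y₂) (^-congˡ (5 ℕ.* q) y₁≈y₂)) (*-congˡ x₁≈x₂)
    where y₁≈y₂ = y-cong x₁≈x₂

  y-shift : ∀ x {a} → Fixed a → y (x + a) ≈ y x
  y-shift x {a} σa≈a = +-congʳ (begin
    σ (x + a) - (x + a)     ≈⟨ +-congʳ (trans (σ-+ x a) (+-congˡ σa≈a)) ⟩
    (σ x + a) - (x + a)     ≈⟨ solve 3 (λ σx x a → (σx :+ a) :- (x :+ a) := σx :- x) refl (σ x) x a ⟩
    σ x - x                 ∎)

  f-shift : ∀ x {a} → Fixed a → f (x + a) ≈ f x + γ * a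
  f-shift x {a} σa≈a = begin
    f (x + a)
      ≈⟨ +-congʳ (+-cong (^-congˡ (2 ℕ.* q ℕ.+ 3) (y-shift x σa≈a)) (^-congˡ (5 ℕ.* q) (y-shift x σa≈a))) ⟩
    y x ^ (2 ℕ.* q ℕ.+ 3) + y x ^ (5 ℕ.* q) + γ * (x + a)
      ≈⟨ solve 4 (λ b g x a → b :+ g :* (x :+ a) := (b :+ g :* x) :+ g :* a) refl _ γ x a ⟩
    f x + γ * a
      ∎

  x^[2q+3]≈x³σx² : ∀ z → z ^ (2 ℕ.* q ℕ.+ 3) ≈ z ^ 3 * σ z ^ 2
  x^[2q+3]≈x³σx² z = begin
    z ^ (2 ℕ.* q ℕ.+ 3)      ≡⟨ ≡.cong (z ^_) (≡.trans (ℕ.+-comm (2 ℕ.* q) 3) (≡.cong (3 ℕ.+_) (ℕ.*-comm 2 q))) ⟩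
    z ^ (3 ℕ.+ q ℕ.* 2)      ≈⟨ ^-homo-* z 3 (q ℕ.* 2) ⟩
    z ^ 3 * z ^ (q ℕ.* 2)    ≈⟨ *-congˡ (^-assocʳ z q 2) ⟨
    z ^ 3 * σ z ^ 2          ∎

  x^[5q]≈σx⁵ : ∀ z → z ^ (5 ℕ.* q) ≈ σ z ^ 5
  x^[5q]≈σx⁵ z = trans (reflexive (≡.cong (z ^_) (ℕ.*-comm 5 q))) (sym (^-assocʳ z q 5))

  f-expand : ∀ x → f x ≈ y x ^ 3 * (t - y x) ^ 2 + (t - y x) ^ 5 + γ * x
  f-expand x = +-congʳ (+-cong
    (trans (x^[2q+3]≈x³σx² (y x)) (*-congˡ (^-congˡ 2 (σy≈t-y x))))
    (trans (x^[5q]≈σx⁵ (y x)) (^-congˡ 5 (σy≈t-y x))))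

  σf-expand : ∀ x → σ (f x) ≈ (t - y x) ^ 3 * y x ^ 2 + y x ^ 5 + γ * σ x
  σf-expand x = trans (trans (σ-+ _ _) (+-congʳ (σ-+ _ _)))
                      (+-cong (+-cong σ[y^[2q+3]] σ[y^[5q]]) (trans (σ-* γ x) (*-congʳ γ^q≈γ)))
    where
    σ[y^[2q+3]] : σ (y x ^ (2 ℕ.* q ℕ.+ 3)) ≈ (t - y x) ^ 3 * y x ^ 2
    σ[y^[2q+3]] = trans (σ-cong (x^[2q+3]≈x³σx² (y x))) (trans (σ-* _ _) (*-cong
      (trans (σ-^ (y x) 3) (^-congˡ 3 (σy≈t-y x)))
      (trans (σ-^ (σ (y x)) 2) (^-congˡ 2 (σ-involutive (y x))))))
    σ[y^[5q]] : σ (y x ^ (5 ℕ.* q)) ≈ y x ^ 5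
    σ[y^[5q]] = trans (σ-cong (x^[5q]≈σx⁵ (y x))) (trans (σ-^ (σ (y x)) 5) (^-congˡ 5 (σ-involutive (y x))))

  G : Carrier → Carrier
  G z = (((t - z) ^ 3 * z ^ 2 + z ^ 5) - (z ^ 3 * (t - z) ^ 2 + (t - z) ^ 5)) + γ * (z - δ)

  σf-f≈G∘y : ∀ x → σ (f x) - f x ≈ G (y x)
  σf-f≈G∘y x = trans (+-cong (σf-expand x) (-‿cong (f-expand x)))
    (solve 8 (λ a b c d g σx x δ → (a :+ b :+ g :* σx) :- (c :+ d :+ g :* x)
                                 := ((a :+ b) :- (c :+ d)) :+ g :* ((σx :- x :+ δ) :- δ)) refl
             ((t - y x) ^ 3 * y x ^ 2) (y x ^ 5) (y x ^ 3 * (t - y x) ^ 2) ((t - y x) ^ 5) γ (σ x) x δ)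

  s : Carrier → Carrier
  s z = 2# * z - t

  K : Carrier → Carrier → Carrier
  K s₁ s₂ = (t ^ 4 + 2# * γ) + (3# * t ^ 2) * Q s₁ s₂

  G-difference : ∀ z₁ z₂ → 2# * (G z₁ - G z₂) ≈ (z₁ - z₂) * K (s z₁) (s z₂)
  G-difference z₁ z₂ = solve 5 (λ z₁ z₂ t γ δ →
    let G′ = λ z → (((t :- z) :^ 3 :* z :^ 2 :+ z :^ 5) :- (z :^ 3 :* (t :- z) :^ 2 :+ (t :- z) :^ 5)) :+ γ :* (z :- δ)
        s′ = λ z → con (ℤ.+ 2) :* z :- t
        Q′ = λ a b → a :* a :+ a :* b :+ b :* b
    in con (ℤ.+ 2) :* (G′ z₁ :- G′ z₂)
       := (z₁ :- z₂) :* ((t :^ 4 :+ con (ℤ.+ 2) :* γ) :+ (con (ℤ.+ 3) :* t :^ 2) :* Q′ (s′ z₁) (s′ z₂)))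
    refl z₁ z₂ t γ δ

  K-cong : ∀ {a₁ a₂ b₁ b₂} → a₁ ≈ a₂ → b₁ ≈ b₂ → K a₁ b₁ ≈ K a₂ b₂
  K-cong a₁≈a₂ b₁≈b₂ =
    +-congˡ (*-congˡ (+-cong (+-cong (*-cong a₁≈a₂ a₁≈a₂) (*-cong a₁≈a₂ b₁≈b₂)) (*-cong b₁≈b₂ b₁≈b₂)))

  2≉0 : 2# ≉ 0#
  2≉0 = prime∤q⇒×1≉0 prime[2] q-odd

  ½ : Carrier
  ½ = inv 2# 2≉0

  σ½≈½ : Fixed ½
  σ½≈½ = Fixed-inv 2≉0 (σ-×1 2)

  s-cong : ∀ {z₁ z₂} → z₁ ≈ z₂ → s z₁ ≈ s z₂
  s-cong z₁≈z₂ = +-congʳ (*-congˡ z₁≈z₂)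

  s-injective : ∀ {z₁ z₂} → s z₁ ≈ s z₂ → z₁ ≈ z₂
  s-injective s₁≈s₂ = *-cancelˡ 2≉0 (+-cancelʳ (- t) _ _ s₁≈s₂)

  s-traceless : ∀ {z} → σ z ≈ t - z → Traceless (s z)
  s-traceless {z} σz≈t-z = begin
    σ (2# * z - t)         ≈⟨ σ-- _ t ⟩
    σ (2# * z) - σ t       ≈⟨ +-cong (trans (σ-* 2# z) (*-cong (σ-×1 2) σz≈t-z)) (-‿cong σt≈t) ⟩
    2# * (t - z) - t       ≈⟨ solve 2 (λ z t → con (ℤ.+ 2) :* (t :- z) :- t := :- (con (ℤ.+ 2) :* z :- t)) refl z t ⟩
    - (2# * z - t)         ∎

  s-onto : ∀ {s₀} → Traceless s₀ → ∃ λ z → σ z ≈ t - z × s z ≈ s₀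
  s-onto {s₀} σs₀≈-s₀ = ½ * (s₀ + t) , σz≈t-z , sz≈s₀
    where
    σz≈t-z : σ (½ * (s₀ + t)) ≈ t - ½ * (s₀ + t)
    σz≈t-z = x∙y⁻¹≈ε⇒x≈y _ _ (begin
      σ (½ * (s₀ + t)) - (t - ½ * (s₀ + t))
        ≈⟨ +-congʳ (trans (σ-* ½ _) (*-cong σ½≈½ (trans (σ-+ s₀ t) (+-cong σs₀≈-s₀ σt≈t)))) ⟩
      ½ * (- s₀ + t) - (t - ½ * (s₀ + t))
        ≈⟨ solve 3 (λ h s t → h :* (:- s :+ t) :- (t :- h :* (s :+ t)) := t :* (con (ℤ.+ 2) :* h :- con (ℤ.+ 1)))
                   refl ½ s₀ t ⟩
      t * (2# * ½ - 1#)
        ≈⟨ *-congˡ (x≈y⇒x∙y⁻¹≈ε (*-inverseʳ 2# 2≉0)) ⟩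
      t * 0#
        ≈⟨ zeroʳ t ⟩
      0#
        ∎)
    sz≈s₀ : 2# * (½ * (s₀ + t)) - t ≈ s₀
    sz≈s₀ = begin
      2# * (½ * (s₀ + t)) - t        ≈⟨ +-congʳ (sym (*-assoc 2# ½ _)) ⟩
      (2# * ½) * (s₀ + t) - t        ≈⟨ +-congʳ (*-congʳ (*-inverseʳ 2# 2≉0)) ⟩
      1# * (s₀ + t) - t              ≈⟨ solve 2 (λ s t → con (ℤ.+ 1) :* (s :+ t) :- t := s) refl s₀ t ⟩
      s₀                             ∎

  y-onto : ∀ {z} → σ z ≈ t - z → ∃ λ x → y x ≈ z
  y-onto {z} σz≈t-z = - (½ * w) , (begin
    σ (- (½ * w)) - - (½ * w) + δ
      ≈⟨ +-congʳ (+-congʳ (trans (σ-‿ _) (-‿cong (trans (σ-* ½ w) (*-cong σ½≈½ σw≈-w))))) ⟩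
    - (½ * - w) - - (½ * w) + δ
      ≈⟨ solve 3 (λ h w δ → :- (h :* :- w) :- :- (h :* w) :+ δ := (con (ℤ.+ 2) :* h) :* w :+ δ) refl ½ w δ ⟩
    (2# * ½) * w + δ
      ≈⟨ +-congʳ (trans (*-congʳ (*-inverseʳ 2# 2≉0)) (*-identityˡ w)) ⟩
    w + δ
      ≈⟨ solve 2 (λ z δ → (z :- δ) :+ δ := z) refl z δ ⟩
    z ∎)
    where
    w = z - δ
    σw≈-w : Traceless w
    σw≈-w = begin
      σ (z - δ)             ≈⟨ σ-- z δ ⟩
      σ z - σ δ             ≈⟨ +-congʳ σz≈t-z ⟩
      (δ + σ δ - z) - σ δ   ≈⟨ solve 3 (λ z δ σδ → ((δ :+ σδ) :- z) :- σδ := :- (z :- δ)) refl z δ (σ δ) ⟩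
      - (z - δ)             ∎

  s∘y-onto : ∀ {s₀} → Traceless s₀ → ∃ λ x → s (y x) ≈ s₀
  s∘y-onto σs₀≈-s₀ =
    let z , σz≈t-z , sz≈s₀ = s-onto σs₀≈-s₀ ; x , yx≈z = y-onto σz≈t-z in x , trans (s-cong yx≈z) sz≈s₀

  -- σ - id kills d = f x₁ - f x₂, so f (x₂ + d / γ) = f x₂ + d = f x₁
  same-G⇒same-y : Injective _≈_ _≈_ f → ∀ {x₁ x₂} → G (y x₁) ≈ G (y x₂) → y x₁ ≈ y x₂
  same-G⇒same-y f-injective {x₁} {x₂} G₁≈G₂ = trans (y-cong (sym x₂+a≈x₁)) (y-shift x₂ σa≈a)
    where
    d = f x₁ - f x₂
    σd≈d : Fixed d
    σd≈d = trans (σ-- (f x₁) (f x₂)) (x∙y⁻¹≈ε⇒x≈y _ _ (begin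
      (σ (f x₁) - σ (f x₂)) - (f x₁ - f x₂)
        ≈⟨ solve 4 (λ a b c e → (a :- b) :- (c :- e) := (a :- c) :- (b :- e)) refl (σ (f x₁)) (σ (f x₂)) (f x₁) (f x₂) ⟩
      (σ (f x₁) - f x₁) - (σ (f x₂) - f x₂)
        ≈⟨ x≈y⇒x∙y⁻¹≈ε (trans (σf-f≈G∘y x₁) (trans G₁≈G₂ (sym (σf-f≈G∘y x₂)))) ⟩
      0# ∎))
    a = inv γ γ≉0 * d
    σa≈a : Fixed a
    σa≈a = Fixed-* (Fixed-inv γ≉0 γ^q≈γ) σd≈d
    x₂+a≈x₁ : x₂ + a ≈ x₁
    x₂+a≈x₁ = f-injective (begin
      f (x₂ + a)                ≈⟨ f-shift x₂ σa≈a ⟩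
      f x₂ + γ * (inv γ γ≉0 * d) ≈⟨ +-congˡ (trans (sym (*-assoc _ _ _)) (*-congʳ (*-inverseʳ γ γ≉0))) ⟩
      f x₂ + 1# * d             ≈⟨ +-congˡ (*-identityˡ d) ⟩
      f x₂ + (f x₁ - f x₂)      ≈⟨ solve 2 (λ u v → u :+ (v :- u) := v) refl (f x₂) (f x₁) ⟩
      f x₁                      ∎)

  CollisionFree : Set (c ⊔ ℓ)
  CollisionFree = ∀ {s₁ s₂} → Traceless s₁ → Traceless s₂ → K s₁ s₂ ≈ 0# → s₁ ≈ s₂

  collisionFree⇒injective : CollisionFree → Injective _≈_ _≈_ f
  collisionFree⇒injective collision-free {x₁} {x₂} fx₁≈fx₂ = *-cancelˡ γ≉0 (+-cancelˡ _ _ _ (begin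
    (y x₂ ^ (2 ℕ.* q ℕ.+ 3) + y x₂ ^ (5 ℕ.* q)) + γ * x₁
      ≈⟨ +-congʳ (+-cong (^-congˡ (2 ℕ.* q ℕ.+ 3) (sym y₁≈y₂)) (^-congˡ (5 ℕ.* q) (sym y₁≈y₂))) ⟩
    f x₁
      ≈⟨ fx₁≈fx₂ ⟩
    f x₂
      ∎))
    where
    G₁≈G₂ : G (y x₁) ≈ G (y x₂)
    G₁≈G₂ = trans (sym (σf-f≈G∘y x₁)) (trans (+-cong (σ-cong fx₁≈fx₂) (-‿cong fx₁≈fx₂)) (σf-f≈G∘y x₂))
    [y₁-y₂]K≈0 : (y x₁ - y x₂) * K (s (y x₁)) (s (y x₂)) ≈ 0#
    [y₁-y₂]K≈0 = trans (sym (G-difference (y x₁) (y x₂))) (trans (*-congˡ (x≈y⇒x∙y⁻¹≈ε G₁≈G₂)) (zeroʳ 2#))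
    K≈0⇒y₁≈y₂ : K (s (y x₁)) (s (y x₂)) ≈ 0# → y x₁ ≈ y x₂
    K≈0⇒y₁≈y₂ = s-injective ∘ collision-free (s-traceless (σy≈t-y x₁)) (s-traceless (σy≈t-y x₂))
    y₁≈y₂ : y x₁ ≈ y x₂
    y₁≈y₂ = [ x∙y⁻¹≈ε⇒x≈y _ _ , K≈0⇒y₁≈y₂ ]′ (x*y≈0⇒x≈0⊎y≈0 [y₁-y₂]K≈0)

  injective⇒collisionFree : Injective _≈_ _≈_ f → CollisionFree
  injective⇒collisionFree f-injective {s₁} {s₂} σs₁≈-s₁ σs₂≈-s₂ K≈0 = begin
    s₁              ≈⟨ s[y₁]≈s₁ ⟨
    s (y x₁)        ≈⟨ s-cong (same-G⇒same-y f-injective G₁≈G₂) ⟩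
    s (y x₂)        ≈⟨ s[y₂]≈s₂ ⟩
    s₂              ∎
    where
    x₁ = proj₁ (s∘y-onto σs₁≈-s₁)
    s[y₁]≈s₁ = proj₂ (s∘y-onto σs₁≈-s₁)
    x₂ = proj₁ (s∘y-onto σs₂≈-s₂)
    s[y₂]≈s₂ = proj₂ (s∘y-onto σs₂≈-s₂)
    G₁≈G₂ : G (y x₁) ≈ G (y x₂)
    G₁≈G₂ = x∙y⁻¹≈ε⇒x≈y _ _ (*-cancelˡ 2≉0 (begin
      2# * (G (y x₁) - G (y x₂))                   ≈⟨ G-difference (y x₁) (y x₂) ⟩
      (y x₁ - y x₂) * K (s (y x₁)) (s (y x₂))      ≈⟨ *-congˡ (trans (K-cong s[y₁]≈s₁ s[y₂]≈s₂) K≈0) ⟩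
      (y x₁ - y x₂) * 0#                           ≈⟨ zeroʳ _ ⟩
      0#                                           ≈⟨ zeroʳ 2# ⟨
      2# * 0#                                      ∎))

  K-split : ∀ s₁ s₂ → K s₁ s₂ ≈ (t ^ 4 - γ) + 3# * (γ + t ^ 2 * Q s₁ s₂)
  K-split s₁ s₂ = solve 4 (λ t γ a b →
    let Q′ = a :* a :+ a :* b :+ b :* b
    in (t :^ 4 :+ con (ℤ.+ 2) :* γ) :+ (con (ℤ.+ 3) :* t :^ 2) :* Q′ := (t :^ 4 :- γ) :+ con (ℤ.+ 3) :* (γ :+ t :^ 2 :* Q′))
    refl t γ s₁ s₂

  3∣q⇒K≈t⁴-γ : 3 ∣ q → ∀ s₁ s₂ → K s₁ s₂ ≈ t ^ 4 - γ
  3∣q⇒K≈t⁴-γ 3∣q s₁ s₂ = begin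
    K s₁ s₂                                       ≈⟨ K-split s₁ s₂ ⟩
    (t ^ 4 - γ) + 3# * (γ + t ^ 2 * Q s₁ s₂)      ≈⟨ +-congˡ (*-congʳ (prime∣q⇒×1≈0 prime[3] 3∣q)) ⟩
    (t ^ 4 - γ) + 0# * (γ + t ^ 2 * Q s₁ s₂)      ≈⟨ +-congˡ (zeroˡ _) ⟩
    (t ^ 4 - γ) + 0#                              ≈⟨ +-identityʳ _ ⟩
    t ^ 4 - γ                                     ∎

  private
    -- K s₁ s₂ = E + D * Q s₁ s₂ vanishes exactly when Q s₁ s₂ = e
    module NonzeroTrace (t≉0 : t ≉ 0#) (3∤q : ¬ 3 ∣ q) where
      D = 3# * t ^ 2
      D≉0 : D ≉ 0#
      D≉0 = *-≉0 (3≉0 3∤q) (^-≉0 2 t≉0)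
      E = t ^ 4 + 2# * γ
      e = - E * inv D D≉0

      eD≈-E : e * D ≈ - E
      eD≈-E = trans (*-assoc _ _ _) (trans (*-congˡ (*-inverseˡ D D≉0)) (*-identityʳ _))

      σe≈e : Fixed e
      σe≈e = Fixed-* (Fixed-‿ (Fixed-+ (Fixed-^ 4 σt≈t) (Fixed-* (σ-×1 2) γ^q≈γ)))
                     (Fixed-inv D≉0 (Fixed-* (σ-×1 3) (Fixed-^ 2 σt≈t)))

      e≈0⇒E≈0 : e ≈ 0# → E ≈ 0#
      e≈0⇒E≈0 e≈0 = -‿injective (trans (sym eD≈-E) (trans (*-congʳ e≈0) (trans (zeroˡ D) (sym -0#≈0#))))

      ¬Q-Represents-e : CollisionFree → ¬ Q-Represents e
      ¬Q-Represents-e collision-free (s₁ , s₂ , σs₁ , σs₂ , s₁≉s₂ , Q≈e) =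
        s₁≉s₂ (collision-free σs₁ σs₂ (begin
          E + D * Q s₁ s₂       ≈⟨ +-congˡ (trans (*-congˡ Q≈e) (trans (*-comm D e) eD≈-E)) ⟩
          E + - E               ≈⟨ -‿inverseʳ E ⟩
          0#                    ∎))

  Conditions : Set ℓ
  Conditions = (t ≈ 0#)
             ⊎ (t ≉ 0# × 3 ∣ q × γ ≉ t ^ 4)
             ⊎ (t ≉ 0# × q % 3 ≡ 2 × 2# * γ ≈ - t ^ 4)

  conditions⇒collisionFree : Conditions → CollisionFree
  conditions⇒collisionFree (inj₁ t≈0) {s₁} {s₂} _ _ K≈0 = ⊥-elim (*-≉0 2≉0 γ≉0 (begin
    2# * γ
      ≈⟨ solve 2 (λ g Q → g := (con (ℤ.+ 0) :^ 4 :+ g) :+ (con (ℤ.+ 3) :* con (ℤ.+ 0) :^ 2) :* Q) refl (2# * γ) (Q s₁ s₂) ⟩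
    (0# ^ 4 + 2# * γ) + (3# * 0# ^ 2) * Q s₁ s₂
      ≈⟨ +-cong (+-congʳ (^-congˡ 4 t≈0)) (*-congʳ (*-congˡ (^-congˡ 2 t≈0))) ⟨
    K s₁ s₂
      ≈⟨ K≈0 ⟩
    0#
      ∎))
  conditions⇒collisionFree (inj₂ (inj₁ (_ , 3∣q , γ≉t⁴))) {s₁} {s₂} _ _ K≈0 =
    ⊥-elim (γ≉t⁴ (sym (x∙y⁻¹≈ε⇒x≈y _ _ (trans (sym (3∣q⇒K≈t⁴-γ 3∣q s₁ s₂)) K≈0))))
  conditions⇒collisionFree (inj₂ (inj₂ (t≉0 , q%3≡2 , 2γ≈-t⁴))) {s₁} {s₂} σs₁ σs₂ K≈0 =
    Q≈0⇒≈ q%3≡2 σs₁ σs₂ ([ ⊥-elim ∘ D≉0 , id ]′ (x*y≈0⇒x≈0⊎y≈0 (begin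
      D * Q s₁ s₂              ≈⟨ +-identityˡ _ ⟨
      0# + D * Q s₁ s₂         ≈⟨ +-congʳ (trans (+-congˡ 2γ≈-t⁴) (-‿inverseʳ _)) ⟨
      K s₁ s₂                  ≈⟨ K≈0 ⟩
      0#                       ∎)))
    where open NonzeroTrace t≉0 (n%3≡1+r⇒3∤n q%3≡2)

  collisionFree⇒conditions : CollisionFree → Conditions
  collisionFree⇒conditions collision-free with t ≟ 0#
  ... | yes t≈0 = inj₁ t≈0
  ... | no  t≉0 with 3 ∣? q
  ...   | yes 3∣q = inj₂ (inj₁ (t≉0 , 3∣q , γ≉t⁴))
    where
    γ≉t⁴ : γ ≉ t ^ 4
    γ≉t⁴ γ≈t⁴ = let ω , σω≈-ω , ω≉0 = traceless-nonzero in
      ω≉0 (sym (collision-free (trans σ-0 (sym -0#≈0#)) σω≈-ω (trans (3∣q⇒K≈t⁴-γ 3∣q 0# ω) (x≈y⇒x∙y⁻¹≈ε (sym γ≈t⁴)))))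
  ...   | no  3∤q = [ q%3≡1⇒⊥ , q%3≡2⇒ ]′ (n%3≡1⊎n%3≡2 q 3∤q)
    where
    open NonzeroTrace t≉0 3∤q
    q%3≡1⇒⊥ : q % 3 ≡ 1 → Conditions
    q%3≡1⇒⊥ q%3≡1 with e ≟ 0#
    ... | yes e≈0 = ⊥-elim (¬Q-Represents-e collision-free (Q-Represents-cong (sym e≈0) (Q-represents-0 q%3≡1)))
    ... | no  e≉0 = ⊥-elim (¬Q-Represents-e collision-free (Q-represents 3∤q σe≈e e≉0))
    q%3≡2⇒ : q % 3 ≡ 2 → Conditions
    q%3≡2⇒ q%3≡2 with e ≟ 0#
    ... | yes e≈0 = inj₂ (inj₂ (t≉0 , q%3≡2 , x∙y⁻¹≈ε⇒x≈y _ _ (begin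
      2# * γ - - t ^ 4         ≈⟨ solve 2 (λ T g → g :- :- T := T :+ g) refl (t ^ 4) (2# * γ) ⟩
      E                        ≈⟨ e≈0⇒E≈0 e≈0 ⟩
      0#                       ∎)))
    ... | no  e≉0 = ⊥-elim (¬Q-Represents-e collision-free (Q-represents 3∤q σe≈e e≉0))

-- imported only here since _×_ also names the ring's multiples n × x in the modules above
open import Data.Product using (_×_)

theorem3p10 : {c ℓ : Level} (q : ℕ) → IsOddPrimePower q →
    (F : CommutativeRing c ℓ) → IsFiniteFieldOfOrder F (q ℕ.* q) →
    let open CommutativeRing F in
    (δ γ : Carrier) → pow F γ q ≈ γ → ¬ (γ ≈ 0#) →
    IsPermutation F (λ x → pow F (pow F x q - x + δ) (2 ℕ.* q ℕ.+ 3)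
                          + pow F (pow F x q - x + δ) (5 ℕ.* q)
                          + γ * x)
    ⇔ ((Tr F q δ ≈ 0#)
       ⊎ (¬ (Tr F q δ ≈ 0#) × 3 ∣ q × ¬ (γ ≈ pow F (Tr F q δ) 4))
       ⊎ (¬ (Tr F q δ ≈ 0#) × q % 3 ≡ 2 × (1# + 1#) * γ ≈ - pow F (Tr F q δ) 4))
theorem3p10 q (p , k , p-prime , k≥1 , q≡p^k , q-odd) F F-finite δ γ γ^q≈γ γ≉0 =
  mk⇔ (collisionFree⇒conditions ∘ injective⇒collisionFree ∘ proj₁)
      (injective⇒bijective f-cong ∘ collisionFree⇒injective ∘ conditions⇒collisionFree)
  where
  open FiniteField F F-finite using (injective⇒bijective)
  open PermutationPolynomial F p-prime k≥1 q≡p^k q-odd F-finite δ γ γ^q≈γ γ≉0
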